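{- For every integer $r\ge 3$ there is an integer $f(r)$ such that every $2$-edge-connected graph of order at least $f(r)$ has: (a) a subgraph that is an $r$-flower, a cycle of order at least $r$, a chain of $r$ cycles, or a member of $\mathscr{K}_{2,r}$; and (b) a topological minor (and hence a minor) that is a triangular $r$-flower, $C_r$, a chain of $r$ triangles, or $K_{2,r}$.
   Context: Graphs are finite and simple. An $r$-flower consists of $r$ edge-disjoint induced cycles pairwise meeting only in one common vertex; it is triangular if every cycle is a triangle. A chain of $n$ blocks is a graph with exactly $n$ blocks whose block-cutvertex tree is a path; a chain of $n$ cycles (triangles) is such a chain in which every block is a cycle (triangle). $\mathscr{K}_{2,r}$ is the family of all subdivisions of $K_{2,r}$. -}

module Defs where

open import Data.Nat using (ℕ; zero; suc; _+_; _*_; _≤_; _<_; _≡ᵇ_; _<ᵇ_; _%_)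
open import Data.Fin using (Fin; toℕ; _≟_)
open import Data.Bool using (Bool; true; false; _∧_; _∨_; not; if_then_else_)
open import Data.Bool.Properties using (∨-comm)
open import Data.List using (List; []; _∷_; _++_; length)
open import Data.List.Membership.Propositional using (_∈_)
open import Data.List.Relation.Unary.Linked using (Linked)
open import Data.List.Relation.Unary.Unique.Propositional using (Unique)
open import Data.Product using (Σ; ∃; _×_; _,_)
open import Data.Sum using (_⊎_)
open import Relation.Nullary using (¬_; yes; no)
open import Relation.Binary.PropositionalEquality using (_≡_; refl; sym)
open import Relation.Binary.Construct.Closure.ReflexiveTransitive using (Star)

record Graph : Set where
  field
    n       : ℕ
    adj     : Fin n → Fin n → Bool
    adj-sym : ∀ i j → adj i j ≡ adj j i
    adj-irr : ∀ i → adj i i ≡ false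

open Graph public

order : Graph → ℕ
order G = n G

Vtx : Graph → Set
Vtx G = Fin (n G)

Edge : (G : Graph) → Vtx G → Vtx G → Set
Edge G x y = adj G x y ≡ true

Connected : Graph → Set
Connected G = ∀ x y → Star (Edge G) x y

EdgeMinus : (G : Graph) → Vtx G → Vtx G → Vtx G → Vtx G → Set
EdgeMinus G u v x y =
  Edge G x y × ¬ ((x ≡ u × y ≡ v) ⊎ (x ≡ v × y ≡ u))

TwoEdgeConnected : Graph → Set
TwoEdgeConnected G =
  2 ≤ order G × Connected G ×
  (∀ u v → Edge G u v → ∀ x y → Star (EdgeMinus G u v) x y)

IsPath : (G : Graph) → List (Vtx G) → Set
IsPath G xs = Unique xs × Linked (Edge G) xs

IsCycle : (G : Graph) → List (Vtx G) → Set
IsCycle G []       = Data.Empty.⊥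
  where import Data.Empty
IsCycle G (x ∷ xs) =
  3 ≤ length (x ∷ xs) × Unique (x ∷ xs) × Linked (Edge G) ((x ∷ xs) ++ (x ∷ []))

-- G has a subgraph that is an r-flower: r cycles through a common vertex
-- c, pairwise meeting only in c.  (Edge-disjointness follows, and each
-- cycle is automatically induced in the union of the cycles.)
HasFlower : ℕ → Graph → Set
HasFlower r G =
  Σ (Vtx G) λ c → Σ (Fin r → List (Vtx G)) λ C →
    (∀ i → IsCycle G (C i)) × (∀ i → c ∈ C i) ×
    (∀ i j → ¬ i ≡ j → ∀ v → v ∈ C i → v ∈ C j → v ≡ c)

HasLongCycle : ℕ → Graph → Set
HasLongCycle r G = Σ (List (Vtx G)) λ C → IsCycle G C × r ≤ length C

-- G has a subgraph that is a chain of r cycles: cycles C 0,…,C (r-1)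
-- such that consecutive ones share exactly one vertex and
-- non-consecutive ones are disjoint.  (Then the union has exactly these
-- r cycles as blocks and its block-cutvertex tree is a path.)
HasCycleChain : ℕ → Graph → Set
HasCycleChain r G =
  Σ (Fin r → List (Vtx G)) λ C →
    (∀ i → IsCycle G (C i)) ×
    (∀ i j → toℕ j ≡ suc (toℕ i) →
       Σ (Vtx G) λ v → v ∈ C i × v ∈ C j ×
         (∀ w → w ∈ C i → w ∈ C j → w ≡ v)) ×
    (∀ i j → 2 + toℕ i ≤ toℕ j → ∀ v → v ∈ C i → ¬ v ∈ C j)

-- G has a subgraph in 𝒦_{2,r}: distinct branch vertices a, b and r
-- a–b paths a ∷ P i ++ [b], each with at least one inner vertex, with
-- pairwise disjoint interiors.
HasK2rSubdivision : ℕ → Graph → Set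
HasK2rSubdivision r G =
  Σ (Vtx G) λ a → Σ (Vtx G) λ b → ¬ a ≡ b ×
  Σ (Fin r → List (Vtx G)) λ P →
    (∀ i → 1 ≤ length (P i)) ×
    (∀ i → IsPath G (a ∷ (P i ++ (b ∷ [])))) ×
    (∀ i j → ¬ i ≡ j → ∀ v → v ∈ P i → ¬ v ∈ P j)

-- H is a topological minor of G: an injective map φ of V(H) into V(G)
-- and, for every edge ij of H (taken with toℕ i < toℕ j), a φi–φj path
-- φ i ∷ Q i j ++ [φ j] in G whose interior avoids φ(V(H)); interiors of
-- paths of distinct edges are disjoint.  (I.e. a subdivision of H is a
-- subgraph of G.)
TopMinor : Graph → Graph → Set
TopMinor H G =
  Σ (Vtx H → Vtx G) λ φ → Σ (Vtx H → Vtx H → List (Vtx G)) λ Q →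
    (∀ i j → φ i ≡ φ j → i ≡ j) ×
    (∀ i j → toℕ i < toℕ j → Edge H i j →
       IsPath G (φ i ∷ (Q i j ++ (φ j ∷ []))) ×
       (∀ v → v ∈ Q i j → ∀ k → ¬ v ≡ φ k)) ×
    (∀ i j k l → toℕ i < toℕ j → Edge H i j → toℕ k < toℕ l → Edge H k l →
       ¬ (i ≡ k × j ≡ l) → ∀ v → v ∈ Q i j → ¬ v ∈ Q k l)

fromRel : (m : ℕ) → (Fin m → Fin m → Bool) → Graph
fromRel m b = record
  { n = m
  ; adj = a
  ; adj-sym = asym
  ; adj-irr = airr
  }
  where
  a : Fin m → Fin m → Bool
  a i j with i ≟ j
  ... | yes _ = false
  ... | no  _ = b i j ∨ b j i
  asym : ∀ i j → a i j ≡ a j i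
  asym i j with i ≟ j | j ≟ i
  ... | yes _ | yes _ = refl
  ... | yes p | no q  = Data.Empty.⊥-elim (q (sym p))
    where import Data.Empty
  ... | no q  | yes p = Data.Empty.⊥-elim (q (sym p))
    where import Data.Empty
  ... | no _  | no _  = ∨-comm (b i j) (b j i)
  airr : ∀ i → a i i ≡ false
  airr i with i ≟ i
  ... | yes _ = refl
  ... | no q  = Data.Empty.⊥-elim (q refl)
    where import Data.Empty

private
  even : ℕ → Bool
  even k = (k % 2) ≡ᵇ 0

CycleGraph : ℕ → Graph
CycleGraph r = fromRel r λ i j →
  (toℕ j ≡ᵇ suc (toℕ i)) ∨ ((suc (toℕ i) ≡ᵇ r) ∧ (toℕ j ≡ᵇ 0))

-- K_{2,r} on 0,…,r+1: vertices 0,1 form one side, 2,…,r+1 the other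
K2 : ℕ → Graph
K2 r = fromRel (2 + r) λ i j → (toℕ i <ᵇ 2) ∧ (1 <ᵇ toℕ j)

-- triangular r-flower on 0,…,2r: centre 0, triangles {0, 2k+1, 2k+2}
TriFlower : ℕ → Graph
TriFlower r = fromRel (suc (2 * r)) λ i j →
  ((toℕ i ≡ᵇ 0) ∧ not (toℕ j ≡ᵇ 0)) ∨
  (not (even (toℕ i)) ∧ (toℕ j ≡ᵇ suc (toℕ i)))

-- chain of r triangles on 0,…,2r: triangles {2k, 2k+1, 2k+2}
TriChain : ℕ → Graph
TriChain r = fromRel (suc (2 * r)) λ i j →
  (toℕ j ≡ᵇ suc (toℕ i)) ∨ (even (toℕ i) ∧ (toℕ j ≡ᵇ 2 + toℕ i))

PartA : ℕ → Graph → Set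
PartA r G =
  HasFlower r G ⊎ HasLongCycle r G ⊎ HasCycleChain r G ⊎ HasK2rSubdivision r G

PartB : ℕ → Graph → Set
PartB r G =
  TopMinor (TriFlower r) G ⊎ TopMinor (CycleGraph r) G ⊎
  TopMinor (TriChain r) G ⊎ TopMinor (K2 r) G

-- A normal spanning tree T of a 2-edge-connected graph gives every non-root vertex v a low edge:
-- an edge from the subtree of v to the root path above v that is not the tree edge at v. If G is
-- large, T has a vertex of depth r³ or a vertex with more than r⁴ children. In the second case,
-- by pigeonhole, r children have low edges ending at the same depth and hence at the same ancestor
-- a of their parent u; the tree paths from these low edges form an r-flower at u if a = u, and a
-- subdivided K₂,ᵣ between a and u otherwise. In the first case the low edges of the vertices on a
-- root path of length r³ are ears over that path. An ear spanning r path vertices closes a long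
-- cycle; otherwise ears can be chained greedily into r consecutive cycles along the path, each
-- spanning at most r² path vertices, unless one of them is already long. Each of these subgraphs
-- contains a subdivision of the corresponding graph of part (b).

module Submission where

open import Defs
open import Data.Bool using (T; not; true)
open import Data.Bool.Properties using (T-≡; T-∧; T-∨) renaming (_≟_ to _≟ᵇ_)
open import Data.Empty using (⊥; ⊥-elim)
open import Data.Fin using (Fin; toℕ; fromℕ<; _≟_)
open import Data.Fin.Properties using (toℕ<n; toℕ-injective; any?; all?; ¬∀⟶∃¬)
open import Data.List using (List; []; _∷_; _++_; [_]; length; reverse; allFin; filter; concatMap)
open import Data.List.Membership.Propositional using (_∈_; _∉_)
open import Data.List.Membership.Propositional.Properties
  using (∈-++⁺ˡ; ∈-++⁺ʳ; ∈-++⁻; ∈-∃++; ∈-allFin; ∈-filter⁺; ∈-filter⁻; ∈-concat⁺′; ∈-map⁺)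
open import Data.List.Properties
  using (++-assoc; ++-identityʳ; length-++; length-++-sucʳ; unfold-reverse; reverse-++; length-reverse; length-tabulate)
open import Data.List.Relation.Binary.Disjoint.Propositional using (Disjoint)
open import Data.List.Relation.Binary.Subset.Propositional using (_⊆_)
open import Data.List.Relation.Unary.All using ([]; _∷_)
open import Data.List.Relation.Unary.All.Properties using (¬Any⇒All¬; All¬⇒¬Any)
import Data.List.Relation.Unary.All.Properties as All
open import Data.List.Relation.Unary.AllPairs using ([]; _∷_)
open import Data.List.Relation.Unary.Any using (here; there)
import Data.List.Relation.Unary.Any.Properties as Any
open import Data.List.Relation.Unary.Linked using (Linked; []; [-]; _∷_)
open import Data.List.Relation.Unary.Unique.Propositional using (Unique)
open import Data.List.Relation.Unary.Unique.Propositional.Properties using (++⁺; filter⁺; allFin⁺)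
open import Data.Nat using (ℕ; zero; suc; pred; >-nonZero; _+_; _*_; _^_; _∸_; _%_; _≡ᵇ_; _≤_; _<_; z≤n; s≤s)
open import Data.Nat.GeneralisedArithmetic using (iterate)
open import Data.Nat.Properties hiding (_≟_)
open import Data.Nat.Properties using () renaming (_≟_ to _≟ℕ_)
open import Data.Product using (Σ; _×_; _,_; proj₁; proj₂)
open import Data.Sum using (_⊎_; inj₁; inj₂; [_,_]′)
open import Data.Unit using (⊤; tt)
open import Data.Vec.Functional using (updateAt)
open import Data.Vec.Functional.Properties using (updateAt-updates; updateAt-minimal)
open import Function using (_∘_; id; const)
open import Function.Bundles using (module Equivalence)
open Equivalence using (to; from)
open import Relation.Binary.Construct.Closure.ReflexiveTransitive using (Star; ε; _◅_)
open import Relation.Binary.Definitions using (tri<; tri≈; tri>)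
open import Relation.Binary.PropositionalEquality using (_≡_; _≢_; refl; sym; trans; cong; cong₂; subst; subst₂; module ≡-Reasoning)
open import Relation.Nullary using (¬_; Dec; yes; no; ¬?)
open import Relation.Nullary.Decidable using (_×-dec_)
open import Relation.Unary using (Decidable)
open import Relation.Unary.Properties using (∁?)

module _ {A : Set} where

  Unique-∷ : ∀ {x} {xs : List A} → x ∉ xs → Unique xs → Unique (x ∷ xs)
  Unique-∷ x∉xs u = ¬Any⇒All¬ _ x∉xs ∷ u

  Unique-∷⇒∉ : ∀ {x} {xs : List A} → Unique (x ∷ xs) → x ∉ xs
  Unique-∷⇒∉ (x≢xs ∷ _) = All¬⇒¬Any x≢xs

  Unique-[_] : ∀ (x : A) → Unique [ x ]
  Unique-[ x ] = [] ∷ []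

  Unique-++⁻ˡ : ∀ (xs : List A) {ys} → Unique (xs ++ ys) → Unique xs
  Unique-++⁻ˡ []       _        = []
  Unique-++⁻ˡ (x ∷ xs) (x≢ ∷ u) = All.++⁻ˡ xs x≢ ∷ Unique-++⁻ˡ xs u

  Unique-++⁻ʳ : ∀ (xs : List A) {ys} → Unique (xs ++ ys) → Unique ys
  Unique-++⁻ʳ []       u       = u
  Unique-++⁻ʳ (x ∷ xs) (_ ∷ u) = Unique-++⁻ʳ xs u

  Unique-++⇒Disjoint : ∀ (xs : List A) {ys} → Unique (xs ++ ys) → Disjoint xs ys
  Unique-++⇒Disjoint (x ∷ xs) (x≢ ∷ _) (here refl , v∈ys) = All¬⇒¬Any (All.++⁻ʳ xs x≢) v∈ys
  Unique-++⇒Disjoint (x ∷ xs) (_ ∷ u)  (there v∈xs , v∈ys) = Unique-++⇒Disjoint xs u (v∈xs , v∈ys)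

  Unique-reverse : ∀ {xs : List A} → Unique xs → Unique (reverse xs)
  Unique-reverse {[]}     _        = []
  Unique-reverse {x ∷ xs} (x≢ ∷ u) rewrite unfold-reverse x xs =
    ++⁺ (Unique-reverse u) Unique-[ x ] λ { (v∈ , here refl) → All¬⇒¬Any x≢ (Any.reverse⁻ v∈) }

  Unique-ends : ∀ {s t} {X : List A} → Unique X → s ∉ X → t ∉ X → s ≢ t → Unique (s ∷ X ++ [ t ])
  Unique-ends {s} {t} {X} u s∉X t∉X s≢t = Unique-∷ s∉ (++⁺ u Unique-[ t ] λ { (v∈X , here refl) → t∉X v∈X })
    where
    s∉ : s ∉ X ++ [ t ]
    s∉ s∈ with ∈-++⁻ X s∈
    ... | inj₁ s∈X        = s∉X s∈X
    ... | inj₂ (here s≡t) = s≢t s≡t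

  Unique-⊆⇒length-≤ : ∀ {xs ys : List A} → Unique xs → xs ⊆ ys → length xs ≤ length ys
  Unique-⊆⇒length-≤ {[]}     _        _   = z≤n
  Unique-⊆⇒length-≤ {x ∷ xs} (x≢ ∷ u) sub with us , vs , refl ← ∈-∃++ (sub (here refl)) =
    subst (suc (length xs) ≤_) (sym (length-++-sucʳ us x vs)) (s≤s (Unique-⊆⇒length-≤ u sub′))
    where
    sub′ : xs ⊆ us ++ vs
    sub′ v∈xs with ∈-++⁻ us (sub (there v∈xs))
    ... | inj₁ v∈us         = ∈-++⁺ˡ v∈us
    ... | inj₂ (here refl)  = ⊥-elim (All¬⇒¬Any x≢ v∈xs)
    ... | inj₂ (there v∈vs) = ∈-++⁺ʳ us v∈vs

  lookupOr : A → List A → ℕ → A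
  lookupOr d []       _       = d
  lookupOr d (y ∷ ys) zero    = y
  lookupOr d (y ∷ ys) (suc k) = lookupOr d ys k

  lookupOr-∈ : ∀ d (xs : List A) {k} → k < length xs → lookupOr d xs k ∈ xs
  lookupOr-∈ d (y ∷ ys) {zero}  _         = here refl
  lookupOr-∈ d (y ∷ ys) {suc k} (s≤s k<n) = there (lookupOr-∈ d ys k<n)

  lookupOr-injective : ∀ d {xs : List A} {k k′} → Unique xs → k < length xs → k′ < length xs →
                       lookupOr d xs k ≡ lookupOr d xs k′ → k ≡ k′
  lookupOr-injective d {y ∷ ys} {zero}  {zero}   _        _         _          _  = refl
  lookupOr-injective d {y ∷ ys} {zero}  {suc k′} (y≢ ∷ _) _         (s≤s k′<n) eq =
    ⊥-elim (All¬⇒¬Any y≢ (subst (_∈ ys) (sym eq) (lookupOr-∈ d ys k′<n)))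
  lookupOr-injective d {y ∷ ys} {suc k} {zero}   (y≢ ∷ _) (s≤s k<n) _          eq =
    ⊥-elim (All¬⇒¬Any y≢ (subst (_∈ ys) eq (lookupOr-∈ d ys k<n)))
  lookupOr-injective d {y ∷ ys} {suc k} {suc k′} (_ ∷ u)  (s≤s k<n) (s≤s k′<n) eq =
    cong suc (lookupOr-injective d u k<n k′<n eq)

  lookupOr-last : ∀ d (xs : List A) y → lookupOr d (xs ++ [ y ]) (length xs) ≡ y
  lookupOr-last d []       y = refl
  lookupOr-last d (x ∷ xs) y = lookupOr-last d xs y

  lookupOr-Linked : ∀ {R : A → A → Set} d {xs : List A} {k} → Linked R xs → suc k < length xs →
                    R (lookupOr d xs k) (lookupOr d xs (suc k))
  lookupOr-Linked d {k = zero}  (r ∷ _)  _         = r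
  lookupOr-Linked d {k = suc k} (_ ∷ rs) (s≤s k<n) = lookupOr-Linked d rs k<n
  lookupOr-Linked d {k = zero}  [-]      (s≤s ())

  split-at : ∀ n (xs : List A) → n < length xs →
             Σ (List A) λ ys → Σ A λ y → Σ (List A) λ zs → xs ≡ ys ++ y ∷ zs × length ys ≡ n
  split-at zero    (x ∷ xs) _         = [] , x , xs , refl , refl
  split-at (suc n) (x ∷ xs) (s≤s n<l) with ys , y , zs , refl , refl ← split-at n xs n<l = x ∷ ys , y , zs , refl , refl

  length-filter+filter-∁ : ∀ {P : A → Set} (P? : Decidable P) xs →
                           length (filter P? xs) + length (filter (∁? P?) xs) ≡ length xs
  length-filter+filter-∁ P? []       = refl
  length-filter+filter-∁ P? (x ∷ xs) with P? x
  ... | yes _ = cong suc (length-filter+filter-∁ P? xs)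
  ... | no  _ = trans (+-suc _ _) (cong suc (length-filter+filter-∁ P? xs))

  fibre? : (f : A → ℕ) → ∀ d → Decidable (λ x → f x ≡ d)
  fibre? f d = (_≟ℕ d) ∘ f

  pigeonhole : ∀ (f : A → ℕ) r K {xs} → Unique xs → (∀ {x} → x ∈ xs → f x < K) → suc (r * K) ≤ length xs →
               Σ ℕ λ d → Σ (List A) λ ys → Unique ys × ys ⊆ xs × (∀ {y} → y ∈ ys → f y ≡ d) × r ≤ length ys
  pigeonhole f r zero    {x ∷ _} _ below _ = ⊥-elim (≤⇒≯ z≤n (below (here refl)))
  pigeonhole f r (suc K) {xs} u below long with r ≤? length (filter (fibre? f K) xs)
  ... | yes r≤ = K , filter (fibre? f K) xs , filter⁺ (fibre? f K) u ,
                 proj₁ ∘ ∈-filter⁻ (fibre? f K) {xs = xs} , proj₂ ∘ ∈-filter⁻ (fibre? f K) {xs = xs} , r≤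
  ... | no r≰ =
    let d , ys , ys-unique , ys⊆ , ys-d , r≤ys = pigeonhole f r K (filter⁺ (∁? (fibre? f K)) u) lower long′
    in  d , ys , ys-unique , proj₁ ∘ ∈-filter⁻ (∁? (fibre? f K)) {xs = xs} ∘ ys⊆ , ys-d , r≤ys
    where
    lower : ∀ {x} → x ∈ filter (∁? (fibre? f K)) xs → f x < K
    lower x∈ with x∈xs , fx≢K ← ∈-filter⁻ (∁? (fibre? f K)) {xs = xs} x∈ with m≤n⇒m<n∨m≡n (below x∈xs)
    ... | inj₁ fx<K = ≤-pred fx<K
    ... | inj₂ fx≡K = ⊥-elim (fx≢K (suc-injective fx≡K))
    long′ : suc (r * K) ≤ length (filter (∁? (fibre? f K)) xs)
    long′ = ≮⇒≥ λ short → <-asym long (begin-strict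
      length xs                                                           ≡⟨ sym (length-filter+filter-∁ (fibre? f K) xs) ⟩
      length (filter (fibre? f K) xs) + length (filter (∁? (fibre? f K)) xs) <⟨ +-mono-<-≤ (≰⇒> r≰) (≤-pred short) ⟩
      r + r * K                                                           ≡⟨ sym (*-suc r K) ⟩
      r * suc K                                                           ∎)
      where open ≤-Reasoning

  length-concatMap-≤ : ∀ {B : Set} (f : B → List A) {D} xs → (∀ x → length (f x) ≤ D) →
                       length (concatMap f xs) ≤ D * length xs
  length-concatMap-≤ f []       _ = z≤n
  length-concatMap-≤ f {D} (x ∷ xs) bound = begin
    length (f x ++ concatMap f xs)            ≡⟨ length-++ (f x) ⟩
    length (f x) + length (concatMap f xs)    ≤⟨ +-mono-≤ (bound x) (length-concatMap-≤ f xs bound) ⟩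
    D + D * length xs                         ≡⟨ sym (*-suc D (length xs)) ⟩
    D * length (x ∷ xs)                       ∎
    where open ≤-Reasoning

bounded-argmax : ∀ {P : ℕ → Set} → Decidable P → (w : ℕ → ℕ) → ∀ n →
                 (∀ j → j ≤ n → ¬ P j) ⊎ Σ ℕ λ i → i ≤ n × P i × (∀ j → j ≤ n → P j → w j ≤ w i)
bounded-argmax P? w zero with P? zero
... | yes p0 = inj₂ (0 , z≤n , p0 , λ { zero _ _ → ≤-refl })
... | no ¬p0 = inj₁ λ { zero _ → ¬p0 }
bounded-argmax P? w (suc n) with bounded-argmax P? w n | P? (suc n)
... | inj₁ none | no ¬pn = inj₁ λ j j≤ → [ (λ j<sn → none j (≤-pred j<sn)) , (λ { refl → ¬pn }) ]′ (m≤n⇒m<n∨m≡n j≤)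
... | inj₁ none | yes pn = inj₂ (suc n , ≤-refl , pn , λ j j≤ pj →
        [ (λ j<sn → ⊥-elim (none j (≤-pred j<sn) pj)) , (λ { refl → ≤-refl }) ]′ (m≤n⇒m<n∨m≡n j≤))
... | inj₂ (i , i≤n , pi , max) | no ¬pn = inj₂ (i , m≤n⇒m≤1+n i≤n , pi , λ j j≤ pj →
        [ (λ j<sn → max j (≤-pred j<sn) pj) , (λ { refl → ⊥-elim (¬pn pj) }) ]′ (m≤n⇒m<n∨m≡n j≤))
... | inj₂ (i , i≤n , pi , max) | yes pn with w (suc n) ≤? w i
...   | yes wn≤wi = inj₂ (i , m≤n⇒m≤1+n i≤n , pi , λ j j≤ pj →
          [ (λ j<sn → max j (≤-pred j<sn) pj) , (λ { refl → wn≤wi }) ]′ (m≤n⇒m<n∨m≡n j≤))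
...   | no wn≰wi = inj₂ (suc n , ≤-refl , pn , λ j j≤ pj →
          [ (λ j<sn → ≤-trans (max j (≤-pred j<sn) pj) (<⇒≤ (≰⇒> wn≰wi))) , (λ { refl → ≤-refl }) ]′ (m≤n⇒m<n∨m≡n j≤))

infixr 5 _∷ˢ_

_∷ˢ_ : ∀ {A : Set} → A → (ℕ → A) → ℕ → A
(a ∷ˢ f) zero    = a
(a ∷ˢ f) (suc k) = f k

module Walks (G : Graph) where

  V : Set
  V = Vtx G

  edge-sym : ∀ {a b} → Edge G a b → Edge G b a
  edge-sym {a} {b} e = trans (adj-sym G b a) e

  data Walk : V → V → List V → Set where
    stop : ∀ a → Walk a a [ a ]
    _▸_  : ∀ {a b c xs} → Edge G a b → Walk b c (b ∷ xs) → Walk a c (a ∷ b ∷ xs)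

  infixr 5 _▸_ _++ʷ_

  Walk⇒Linked : ∀ {a b xs} → Walk a b xs → Linked (Edge G) xs
  Walk⇒Linked (stop a) = [-]
  Walk⇒Linked (e ▸ w)  = e ∷ Walk⇒Linked w

  _++ʷ_ : ∀ {a b c xs ys} → Walk a b (a ∷ xs) → Walk b c (b ∷ ys) → Walk a c (a ∷ xs ++ ys)
  stop a   ++ʷ w₂ = w₂
  (e ▸ w₁) ++ʷ w₂ = e ▸ (w₁ ++ʷ w₂)

  walk-snoc : ∀ {a b c xs} → Walk a b xs → Edge G b c → Walk a c (xs ++ [ c ])
  walk-snoc (stop a)  e = e ▸ stop _
  walk-snoc (e₁ ▸ w)  e = e₁ ▸ walk-snoc w e

  walk-reverse : ∀ {a b xs} → Walk a b (a ∷ xs) → Walk b a (reverse (a ∷ xs))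
  walk-reverse (stop a) = stop a
  walk-reverse {a} (_▸_ {b = b} {xs = xs} e w) rewrite unfold-reverse a (b ∷ xs) =
    walk-snoc (walk-reverse w) (edge-sym e)

  Arc : V → V → List V → Set
  Arc s t X = Walk s t (s ∷ X ++ [ t ])

  arc-reverse : ∀ {s t X} → Arc s t X → Arc t s (reverse X)
  arc-reverse {s} {t} {X} w = subst (Walk t s) reverse-arc (walk-reverse w)
    where
    reverse-arc : reverse (s ∷ X ++ [ t ]) ≡ t ∷ reverse X ++ [ s ]
    reverse-arc = trans (unfold-reverse s (X ++ [ t ])) (cong (_++ [ s ]) (reverse-++ X [ t ]))

  arc-++ : ∀ {a b c X Y} → Arc a b X → Arc b c Y → Arc a c (X ++ b ∷ Y)
  arc-++ {a} {b} {c} {X} {Y} w₁ w₂ = subst (λ zs → Walk a c (a ∷ zs)) reassoc (w₁ ++ʷ w₂)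
    where
    reassoc : (X ++ [ b ]) ++ Y ++ [ c ] ≡ (X ++ b ∷ Y) ++ [ c ]
    reassoc = trans (++-assoc X [ b ] (Y ++ [ c ])) (sym (++-assoc X (b ∷ Y) [ c ]))

  arc-split : ∀ {a c} X b Y → Arc a c (X ++ b ∷ Y) → Arc a b X × Arc b c Y
  arc-split []      b Y (e ▸ w) = e ▸ stop b , w
  arc-split (x ∷ X) b Y (e ▸ w) with w₁ , w₂ ← arc-split X b Y w = e ▸ w₁ , w₂

  arc-head : ∀ {a b x X} → Arc a b (x ∷ X) → Edge G a x
  arc-head (e ▸ _) = e

  arc-tail : ∀ {a b x X} → Arc a b (x ∷ X) → Arc x b X
  arc-tail (_ ▸ w) = w

  arc⇒IsPath : ∀ {s t X} → Arc s t X → Unique X → s ∉ X → t ∉ X → s ≢ t → IsPath G (s ∷ X ++ [ t ])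
  arc⇒IsPath w u s∉X t∉X s≢t = Unique-ends u s∉X t∉X s≢t , Walk⇒Linked w

  record ArcPair (s t : V) : Set where
    field
      X Y        : List V
      arcX       : Arc s t X
      arcY       : Arc s t Y
      unique-X   : Unique X
      unique-Y   : Unique Y
      disjoint   : Disjoint X Y
      s≢t        : s ≢ t
      s∉X        : s ∉ X
      s∉Y        : s ∉ Y
      t∉X        : t ∉ X
      t∉Y        : t ∉ Y
      X-nonempty : 1 ≤ length X

  module _ {s t : V} (A : ArcPair s t) where
    open ArcPair A

    cycle : List V
    cycle = s ∷ X ++ t ∷ reverse Y

    cycle-length : length cycle ≡ 2 + (length X + length Y)
    cycle-length = cong suc (begin
      length (X ++ t ∷ reverse Y)        ≡⟨ length-++ X ⟩
      length X + suc (length (reverse Y)) ≡⟨ cong (λ n → length X + suc n) (length-reverse Y) ⟩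
      length X + suc (length Y)          ≡⟨ +-suc (length X) (length Y) ⟩
      suc (length X + length Y)          ∎)
      where open ≡-Reasoning

    X-uncons : Σ V λ h → Σ (List V) λ rest → X ≡ h ∷ rest
    X-uncons with X | X-nonempty
    ... | h ∷ rest | _ = h , rest , refl

    t∈cycle : t ∈ cycle
    t∈cycle = there (∈-++⁺ʳ X (here refl))

    cycle-∈ : ∀ {v} → v ∈ cycle → v ≡ s ⊎ v ≡ t ⊎ v ∈ X ⊎ v ∈ Y
    cycle-∈ (here v≡s) = inj₁ v≡s
    cycle-∈ (there v∈) with ∈-++⁻ X v∈
    ... | inj₁ v∈X         = inj₂ (inj₂ (inj₁ v∈X))
    ... | inj₂ (here v≡t)  = inj₂ (inj₁ v≡t)
    ... | inj₂ (there v∈Y) = inj₂ (inj₂ (inj₂ (Any.reverse⁻ v∈Y)))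

    cycle-isCycle : IsCycle G cycle
    cycle-isCycle = long , Unique-∷ s∉ (++⁺ unique-X (Unique-∷ t∉rY (Unique-reverse unique-Y)) X#tY) , linked
      where
      long : 3 ≤ length cycle
      long = subst (3 ≤_) (sym cycle-length) (s≤s (s≤s (≤-trans X-nonempty (m≤m+n (length X) (length Y)))))
      t∉rY : t ∉ reverse Y
      t∉rY t∈ = t∉Y (Any.reverse⁻ t∈)
      s∉ : s ∉ X ++ t ∷ reverse Y
      s∉ s∈ with ∈-++⁻ X s∈
      ... | inj₁ s∈X         = s∉X s∈X
      ... | inj₂ (here s≡t)  = s≢t s≡t
      ... | inj₂ (there s∈Y) = s∉Y (Any.reverse⁻ s∈Y)
      X#tY : Disjoint X (t ∷ reverse Y)
      X#tY (v∈X , here refl)  = t∉X v∈X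
      X#tY (v∈X , there v∈rY) = disjoint (v∈X , Any.reverse⁻ v∈rY)
      linked : Linked (Edge G) (cycle ++ [ s ])
      linked = subst (Linked (Edge G)) reassoc (Walk⇒Linked (arcX ++ʷ arc-reverse arcY))
        where
        reassoc : s ∷ (X ++ [ t ]) ++ reverse Y ++ [ s ] ≡ cycle ++ [ s ]
        reassoc = cong (s ∷_) (trans (++-assoc X [ t ] (reverse Y ++ [ s ])) (sym (++-assoc X (t ∷ reverse Y) [ s ])))

  arcPair : ∀ {s t} (P Q : List V) → Arc s t P → Arc s t Q → Unique P → Unique Q → Disjoint P Q → s ≢ t →
            s ∉ P → s ∉ Q → t ∉ P → t ∉ Q → 1 ≤ length P + length Q →
            Σ (ArcPair s t) λ A → length (cycle A) ≡ 2 + (length P + length Q) ×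
                                  (∀ {v} → v ∈ ArcPair.X A ++ ArcPair.Y A → v ∈ P ⊎ v ∈ Q)
  arcPair (x ∷ P) Q wP wQ uP uQ P#Q s≢t s∉P s∉Q t∉P t∉Q _ = A , cycle-length A , ∈-++⁻ (x ∷ P)
    where
    A : ArcPair _ _
    A = record { X = x ∷ P ; Y = Q ; arcX = wP ; arcY = wQ ; unique-X = uP ; unique-Y = uQ ; disjoint = P#Q
               ; s≢t = s≢t ; s∉X = s∉P ; s∉Y = s∉Q ; t∉X = t∉P ; t∉Y = t∉Q ; X-nonempty = s≤s z≤n }
  arcPair [] Q wP wQ uP uQ P#Q s≢t s∉P s∉Q t∉P t∉Q Q-nonempty =
    A , trans (cycle-length A) (cong (2 +_) (+-identityʳ (length Q))) , λ v∈ → inj₂ (subst (_ ∈_) (++-identityʳ Q) v∈)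
    where
    A : ArcPair _ _
    A = record { X = Q ; Y = [] ; arcX = wQ ; arcY = wP ; unique-X = uQ ; unique-Y = [] ; disjoint = λ ()
               ; s≢t = s≢t ; s∉X = s∉Q ; s∉Y = s∉P ; t∉X = t∉Q ; t∉Y = t∉P ; X-nonempty = Q-nonempty }

fromRel-edge : ∀ m {b} (i j : Fin m) → Edge (fromRel m b) i j → T (b i j) ⊎ T (b j i)
fromRel-edge m i j e with i ≟ j
... | no _ = to T-∨ (from T-≡ e)

module K2rSubdivisions (G : Graph) where
  open Walks G

  record SubdividedK2r (r : ℕ) : Set where
    field
      a b      : V
      a≢b      : a ≢ b
      first    : ℕ → V
      rest     : ℕ → List V
      arc      : ∀ {q} → q < r → Arc a b (first q ∷ rest q)
      unique   : ∀ {q} → q < r → Unique (first q ∷ rest q)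
      a∉       : ∀ {q} → q < r → a ∉ first q ∷ rest q
      b∉       : ∀ {q} → q < r → b ∉ first q ∷ rest q
      disjoint : ∀ {q q′} → q < r → q′ < r → q ≢ q′ → Disjoint (first q ∷ rest q) (first q′ ∷ rest q′)

  module _ {r : ℕ} (K : SubdividedK2r r) where
    open SubdividedK2r K

    hasK2rSubdivision : HasK2rSubdivision r G
    hasK2rSubdivision =
      a , b , a≢b , (λ i → first (toℕ i) ∷ rest (toℕ i)) , (λ _ → s≤s z≤n) ,
      (λ i → arc⇒IsPath (arc (toℕ<n i)) (unique (toℕ<n i)) (a∉ (toℕ<n i)) (b∉ (toℕ<n i)) a≢b) ,
      λ i j i≢j v v∈i v∈j → disjoint (toℕ<n i) (toℕ<n j) (i≢j ∘ toℕ-injective) (v∈i , v∈j)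

    branch : ℕ → V
    branch zero          = a
    branch (suc zero)    = b
    branch (suc (suc q)) = first q

    interior : ℕ → ℕ → List V
    interior (suc zero) (suc (suc q)) = reverse (rest q)
    interior _          _             = []

    interior-∈ : ∀ x y {v} → v ∈ interior x y → Σ ℕ λ q → x ≡ 1 × y ≡ 2 + q × v ∈ rest q
    interior-∈ (suc zero) (suc (suc q)) v∈ = q , refl , refl , Any.reverse⁻ v∈

    K2-edge : ∀ {i j : Fin (2 + r)} → Edge (K2 r) i j → toℕ i < toℕ j → toℕ i < 2 × 2 ≤ toℕ j
    K2-edge {i} {j} e i<j with fromRel-edge (2 + r) i j e
    ... | inj₁ t = <ᵇ⇒< (toℕ i) 2 (proj₁ (to T-∧ t)) , <ᵇ⇒< 1 (toℕ j) (proj₂ (to T-∧ t))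
    ... | inj₂ t = ⊥-elim (<-asym i<j (<-≤-trans (<ᵇ⇒< (toℕ j) 2 (proj₁ (to T-∧ t))) (<ᵇ⇒< 1 (toℕ i) (proj₂ (to T-∧ t)))))

    branch-path : ∀ {x y} → x < 2 → 2 ≤ y → y < 2 + r → IsPath G (branch x ∷ interior x y ++ [ branch y ])
    branch-path {zero} {suc (suc q)} _ _ (s≤s (s≤s q<r)) =
      Unique-ends [] (λ ()) (λ ()) (a∉ q<r ∘ here) , arc-head (arc q<r) ∷ [-]
    branch-path {suc zero} {suc (suc q)} _ _ (s≤s (s≤s q<r)) with unique q<r
    ... | first∉ ∷ rest-unique =
      arc⇒IsPath (arc-reverse (arc-tail (arc q<r))) (Unique-reverse rest-unique)
                 (b∉ q<r ∘ there ∘ Any.reverse⁻) (All¬⇒¬Any first∉ ∘ Any.reverse⁻) (b∉ q<r ∘ here)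
    branch-path {suc (suc _)} (s≤s (s≤s ())) _ _
    branch-path {y = zero}     _ ()       _
    branch-path {y = suc zero} _ (s≤s ()) _

    branch-injective : ∀ {x y} → x < 2 + r → y < 2 + r → branch x ≡ branch y → x ≡ y
    branch-injective {zero}        {zero}        _ _ _ = refl
    branch-injective {suc zero}    {suc zero}    _ _ _ = refl
    branch-injective {zero}        {suc zero}    _ _ a≡b = ⊥-elim (a≢b a≡b)
    branch-injective {suc zero}    {zero}        _ _ b≡a = ⊥-elim (a≢b (sym b≡a))
    branch-injective {zero}        {suc (suc y)} _ y< eq = ⊥-elim (a∉ (+-cancelˡ-< 2 y r y<) (here eq))
    branch-injective {suc (suc x)} {zero}        x< _ eq = ⊥-elim (a∉ (+-cancelˡ-< 2 x r x<) (here (sym eq)))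
    branch-injective {suc zero}    {suc (suc y)} _ y< eq = ⊥-elim (b∉ (+-cancelˡ-< 2 y r y<) (here eq))
    branch-injective {suc (suc x)} {suc zero}    x< _ eq = ⊥-elim (b∉ (+-cancelˡ-< 2 x r x<) (here (sym eq)))
    branch-injective {suc (suc x)} {suc (suc y)} x< y< eq with x ≟ℕ y
    ... | yes refl = refl
    ... | no x≢y   = ⊥-elim (disjoint (+-cancelˡ-< 2 x r x<) (+-cancelˡ-< 2 y r y<) x≢y (here refl , here eq))

    rest-avoids-branch : ∀ {q v k} → q < r → v ∈ rest q → k < 2 + r → v ≢ branch k
    rest-avoids-branch {k = zero}        q<r v∈ _ refl = a∉ q<r (there v∈)
    rest-avoids-branch {k = suc zero}    q<r v∈ _ refl = b∉ q<r (there v∈)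
    rest-avoids-branch {q} {k = suc (suc k)} q<r v∈ k< refl with q ≟ℕ k
    ... | yes refl = Unique-∷⇒∉ (unique q<r) v∈
    ... | no q≢k   = disjoint q<r (+-cancelˡ-< 2 k r k<) q≢k (there v∈ , here refl)

    K2-topMinor : TopMinor (K2 r) G
    K2-topMinor = branch ∘ toℕ , (λ i j → interior (toℕ i) (toℕ j)) ,
                  (λ i j eq → toℕ-injective (branch-injective (toℕ<n i) (toℕ<n j) eq)) , edge-path , interiors-disjoint
      where
      y<r : ∀ {y q} → y < 2 + r → y ≡ 2 + q → q < r
      y<r y< refl = +-cancelˡ-< 2 _ r y<

      edge-path : ∀ i j → toℕ i < toℕ j → Edge (K2 r) i j →
                  IsPath G (branch (toℕ i) ∷ interior (toℕ i) (toℕ j) ++ [ branch (toℕ j) ]) ×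
                  (∀ v → v ∈ interior (toℕ i) (toℕ j) → ∀ k → ¬ v ≡ branch (toℕ k))
      edge-path i j i<j e with i<2 , 2≤j ← K2-edge e i<j = branch-path i<2 2≤j (toℕ<n j) , avoids
        where
        avoids : ∀ v → v ∈ interior (toℕ i) (toℕ j) → ∀ k → ¬ v ≡ branch (toℕ k)
        avoids v v∈ k with q , _ , j≡ , v∈rest ← interior-∈ (toℕ i) (toℕ j) v∈ =
          rest-avoids-branch (y<r (toℕ<n j) j≡) v∈rest (toℕ<n k)

      interiors-disjoint : ∀ i j k l → toℕ i < toℕ j → Edge (K2 r) i j → toℕ k < toℕ l → Edge (K2 r) k l →
                           ¬ (i ≡ k × j ≡ l) → ∀ v → v ∈ interior (toℕ i) (toℕ j) → ¬ v ∈ interior (toℕ k) (toℕ l)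
      interiors-disjoint i j k l _ _ _ _ ij≢kl v v∈ij v∈kl
        with q , i≡1 , j≡ , v∈q ← interior-∈ (toℕ i) (toℕ j) v∈ij
           | q′ , k≡1 , l≡ , v∈q′ ← interior-∈ (toℕ k) (toℕ l) v∈kl
           | q ≟ℕ q′
      ... | yes refl = ij≢kl (toℕ-injective (trans i≡1 (sym k≡1)) , toℕ-injective (trans j≡ (sym l≡)))
      ... | no q≢q′  = disjoint (y<r (toℕ<n j) j≡) (y<r (toℕ<n l) l≡) q≢q′ (there v∈q , there v∈q′)

data Half : Set where
  even odd : ℕ → Half

next : Half → Half
next (even k) = even (suc k)
next (odd k)  = odd (suc k)

half : ℕ → Half
half zero          = even 0
half (suc zero)    = odd 0
half (suc (suc m)) = next (half m)

unhalf : Half → ℕ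
unhalf (even k) = k + k
unhalf (odd k)  = suc (k + k)

unhalf-half : ∀ m → unhalf (half m) ≡ m
unhalf-half zero          = refl
unhalf-half (suc zero)    = refl
unhalf-half (suc (suc m)) with half m | unhalf-half m
... | even k | refl = cong suc (+-suc k k)
... | odd k  | refl = cong (suc ∘ suc) (+-suc k k)

half-injective : ∀ {m m′} → half m ≡ half m′ → m ≡ m′
half-injective {m} {m′} eq = trans (sym (unhalf-half m)) (trans (cong unhalf eq) (unhalf-half m′))

successor : Half → Half
successor (even k) = odd k
successor (odd k)  = even (suc k)

half-suc : ∀ m → half (suc m) ≡ successor (half m)
half-suc zero          = refl
half-suc (suc zero)    = refl
half-suc (suc (suc m)) = trans (cong next (half-suc m)) (next-successor (half m))
  where
  next-successor : ∀ h → next (successor h) ≡ successor (next h)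
  next-successor (even k) = refl
  next-successor (odd k)  = refl

half-even : ∀ m → T ((m % 2) ≡ᵇ 0) → Σ ℕ λ k → half m ≡ even k
half-even zero          _ = 0 , refl
half-even (suc (suc m)) t with k , eq ← half-even m t = suc k , cong next eq

half-odd : ∀ m → T (not ((m % 2) ≡ᵇ 0)) → Σ ℕ λ k → half m ≡ odd k
half-odd (suc zero)    _ = 0 , refl
half-odd (suc (suc m)) t with k , eq ← half-odd m t = suc k , cong next eq

double-≤⇒≤ : ∀ {a r} → a + a ≤ 2 * r → a ≤ r
double-≤⇒≤ {a} {r} le = *-cancelˡ-≤ 2 (subst (_≤ 2 * r) (cong (a +_) (sym (+-identityʳ a))) le)

double-<⇒< : ∀ {a r} → a + a < 2 * r → a < r
double-<⇒< {a} {r} lt = *-cancelˡ-< 2 a r (subst (_< 2 * r) (cong (a +_) (sym (+-identityʳ a))) lt)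

half-even-≤ : ∀ {m k r} → m ≤ 2 * r → half m ≡ even k → k ≤ r
half-even-≤ {m} m≤ eq = double-≤⇒≤ (subst (_≤ _) (trans (sym (unhalf-half m)) (cong unhalf eq)) m≤)

half-odd-< : ∀ {m k r} → m ≤ 2 * r → half m ≡ odd k → k < r
half-odd-< {m} m≤ eq = double-<⇒< (subst (_≤ _) (trans (sym (unhalf-half m)) (cong unhalf eq)) m≤)

module Flowers (G : Graph) where
  open Walks G

  record Flower (r : ℕ) : Set where
    field
      centre       : V
      first last  : ℕ → V
      middle       : ℕ → List V
      centre-first : ∀ {q} → q < r → Edge G centre (first q)
      last-centre  : ∀ {q} → q < r → Edge G (last q) centre
      arc          : ∀ {q} → q < r → Arc (first q) (last q) (middle q)
      unique       : ∀ {q} → q < r → Unique (first q ∷ middle q ++ [ last q ])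
      centre∉      : ∀ {q} → q < r → centre ∉ first q ∷ middle q ++ [ last q ]
      disjoint     : ∀ {q q′} → q < r → q′ < r → q ≢ q′ →
                     Disjoint (first q ∷ middle q ++ [ last q ]) (first q′ ∷ middle q′ ++ [ last q′ ])

  module _ {r : ℕ} (F : Flower r) where
    open Flower F

    petal : ℕ → List V
    petal q = first q ∷ middle q ++ [ last q ]

    last∈petal : ∀ q → last q ∈ petal q
    last∈petal q = there (∈-++⁺ʳ (middle q) (here refl))

    petal-isCycle : ∀ {q} → q < r → IsCycle G (centre ∷ petal q)
    petal-isCycle {q} q<r =
      s≤s (s≤s (subst (1 ≤_) (sym (length-++ (middle q))) (m≤n+m 1 (length (middle q))))) ,
      Unique-∷ (centre∉ q<r) (unique q<r) ,
      Walk⇒Linked (centre-first q<r ▸ walk-snoc (arc q<r) (last-centre q<r))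

    hasFlower : HasFlower r G
    hasFlower = centre , (λ i → centre ∷ petal (toℕ i)) , (λ i → petal-isCycle (toℕ<n i)) , (λ _ → here refl) , meet
      where
      meet : ∀ i j → i ≢ j → ∀ v → v ∈ centre ∷ petal (toℕ i) → v ∈ centre ∷ petal (toℕ j) → v ≡ centre
      meet i j i≢j v (here v≡c) _          = v≡c
      meet i j i≢j v (there _)  (here v≡c) = v≡c
      meet i j i≢j v (there v∈) (there v∈′) =
        ⊥-elim (disjoint (toℕ<n i) (toℕ<n j) (i≢j ∘ toℕ-injective) (v∈ , v∈′))

    same-petal : ∀ {q q′ v} → q < r → q′ < r → v ∈ petal q → v ∈ petal q′ → q ≡ q′
    same-petal {q} {q′} q<r q′<r v∈ v∈′ with q ≟ℕ q′
    ... | yes q≡q′ = q≡q′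
    ... | no q≢q′  = ⊥-elim (disjoint q<r q′<r q≢q′ (v∈ , v∈′))

    first∉ : ∀ {q} → q < r → first q ∉ middle q ++ [ last q ]
    first∉ q<r = Unique-∷⇒∉ (unique q<r)

    last∉middle : ∀ {q} → q < r → last q ∉ middle q
    last∉middle {q} q<r l∈ with unique q<r
    ... | _ ∷ u = Unique-++⇒Disjoint (middle q) u (l∈ , here refl)

    -- Vertex 0 is the centre and petal q occupies 2q+1 and 2q+2, i.e. halves odd q and even (suc q).
    vertex : Half → V
    vertex (even zero)    = centre
    vertex (even (suc q)) = last q
    vertex (odd q)        = first q

    InFlower : Half → Set
    InFlower (even zero)    = ⊤
    InFlower (even (suc q)) = q < r
    InFlower (odd q)        = q < r

    inFlower : (i : Fin (suc (2 * r))) → InFlower (half (toℕ i))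
    inFlower i with half (toℕ i) in eq
    ... | even zero    = tt
    ... | even (suc q) = half-even-≤ (≤-pred (toℕ<n i)) eq
    ... | odd q        = half-odd-< (≤-pred (toℕ<n i)) eq

    vertex-injective : ∀ {h h′} → InFlower h → InFlower h′ → vertex h ≡ vertex h′ → h ≡ h′
    vertex-injective {even zero}    {even zero}     _   _    _  = refl
    vertex-injective {even zero}    {even (suc q)}  _   q<r  eq = ⊥-elim (centre∉ q<r (subst (_∈ petal q) (sym eq) (last∈petal q)))
    vertex-injective {even zero}    {odd q}         _   q<r  eq = ⊥-elim (centre∉ q<r (here eq))
    vertex-injective {even (suc q)} {even zero}     q<r _    eq = ⊥-elim (centre∉ q<r (subst (_∈ petal q) eq (last∈petal q)))
    vertex-injective {odd q}        {even zero}     q<r _    eq = ⊥-elim (centre∉ q<r (here (sym eq)))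
    vertex-injective {even (suc q)} {even (suc q′)} q<r q′<r eq =
      cong (even ∘ suc) (same-petal q<r q′<r (last∈petal q) (subst (_∈ petal q′) (sym eq) (last∈petal q′)))
    vertex-injective {odd q}        {odd q′}        q<r q′<r eq =
      cong odd (same-petal q<r q′<r (here refl) (here eq))
    vertex-injective {even (suc q)} {odd q′}        q<r q′<r eq
      with refl ← same-petal q<r q′<r (last∈petal q) (here eq) =
      ⊥-elim (first∉ q<r (subst (_∈ _) eq (∈-++⁺ʳ (middle q) (here refl))))
    vertex-injective {odd q}        {even (suc q′)} q<r q′<r eq
      with refl ← same-petal q<r q′<r (here refl) (subst (_∈ petal q′) (sym eq) (last∈petal q′)) =
      ⊥-elim (first∉ q<r (subst (_∈ _) (sym eq) (∈-++⁺ʳ (middle q) (here refl))))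

    between : Half → Half → List V
    between (odd q)  _ = middle q
    between (even _) _ = []

    middle-avoids : ∀ {q v h} → q < r → v ∈ middle q → InFlower h → v ≢ vertex h
    middle-avoids {h = even zero}    q<r v∈ _    refl = centre∉ q<r (there (∈-++⁺ˡ v∈))
    middle-avoids {q} {h = even (suc q′)} q<r v∈ q′<r refl
      with refl ← same-petal q<r q′<r (there (∈-++⁺ˡ v∈)) (last∈petal q′) = last∉middle q<r v∈
    middle-avoids {q} {h = odd q′}   q<r v∈ q′<r refl
      with refl ← same-petal q<r q′<r (there (∈-++⁺ˡ v∈)) (here refl) = first∉ q<r (∈-++⁺ˡ v∈)

    data FlowerEdge (h h′ : Half) : Set where
      spoke : h ≡ even 0 → h′ ≢ even 0 → FlowerEdge h h′
      rim   : ∀ q → h ≡ odd q → h′ ≡ even (suc q) → FlowerEdge h h′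

    flowerEdge : ∀ {i j : Fin (suc (2 * r))} → Edge (TriFlower r) i j → toℕ i < toℕ j →
                 FlowerEdge (half (toℕ i)) (half (toℕ j))
    flowerEdge {i} {j} e i<j with fromRel-edge (suc (2 * r)) i j e
    ... | inj₁ t with to T-∨ t
    ...   | inj₁ s = spoke (cong half i≡0) λ eq → <⇒≢ (≤-trans (s≤s z≤n) i<j) (sym (half-injective eq))
      where
      i≡0 : toℕ i ≡ 0
      i≡0 = ≡ᵇ⇒≡ (toℕ i) 0 (proj₁ (to T-∧ s))
    ...   | inj₂ s with q , eq ← half-odd (toℕ i) (proj₁ (to T-∧ s)) =
      rim q eq (trans (cong half (≡ᵇ⇒≡ (toℕ j) _ (proj₂ (to T-∧ s)))) (trans (half-suc (toℕ i)) (cong successor eq)))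
    flowerEdge {i} {j} e i<j | inj₂ t with to T-∨ t
    ...   | inj₁ s = ⊥-elim (<⇒≢ (≤-trans (s≤s z≤n) i<j) (sym (≡ᵇ⇒≡ (toℕ j) 0 (proj₁ (to T-∧ s)))))
    ...   | inj₂ s = ⊥-elim (<-asym i<j (≤-reflexive (sym (≡ᵇ⇒≡ (toℕ i) _ (proj₂ (to T-∧ s))))))

    edge-path : ∀ {h h′} → FlowerEdge h h′ → InFlower h′ → IsPath G (vertex h ∷ between h h′ ++ [ vertex h′ ])
    edge-path {h′ = even zero}    (spoke refl h′≢0) _ = ⊥-elim (h′≢0 refl)
    edge-path {h′ = even (suc q)} (spoke refl _) q<r =
      Unique-ends [] (λ ()) (λ ()) (λ c≡l → centre∉ q<r (subst (_∈ petal q) (sym c≡l) (last∈petal q))) ,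
      edge-sym (last-centre q<r) ∷ [-]
    edge-path {h′ = odd q}        (spoke refl _) q<r =
      Unique-ends [] (λ ()) (λ ()) (centre∉ q<r ∘ here) , centre-first q<r ∷ [-]
    edge-path (rim q refl refl) q<r = unique q<r , Walk⇒Linked (arc q<r)

    rim-target : ∀ {q h′} → FlowerEdge (odd q) h′ → h′ ≡ even (suc q)
    rim-target (rim q refl eq) = eq

    TriFlower-topMinor : TopMinor (TriFlower r) G
    TriFlower-topMinor = vertex ∘ half ∘ toℕ , (λ i j → between (half (toℕ i)) (half (toℕ j))) ,
      (λ i j eq → toℕ-injective (half-injective (vertex-injective (inFlower i) (inFlower j) eq))) , paths , interiors-disjoint
      where
      paths : ∀ i j → toℕ i < toℕ j → Edge (TriFlower r) i j →
              IsPath G (vertex (half (toℕ i)) ∷ between (half (toℕ i)) (half (toℕ j)) ++ [ vertex (half (toℕ j)) ]) ×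
              (∀ v → v ∈ between (half (toℕ i)) (half (toℕ j)) → ∀ k → ¬ v ≡ vertex (half (toℕ k)))
      paths i j i<j e = edge-path (flowerEdge e i<j) (inFlower j) , avoids
        where
        avoids : ∀ v → v ∈ between (half (toℕ i)) (half (toℕ j)) → ∀ k → ¬ v ≡ vertex (half (toℕ k))
        avoids v v∈ k with half (toℕ i) | inFlower i
        ... | odd q | q<r = middle-avoids q<r v∈ (inFlower k)

      interiors-disjoint : ∀ i j k l → toℕ i < toℕ j → Edge (TriFlower r) i j → toℕ k < toℕ l → Edge (TriFlower r) k l →
                           ¬ (i ≡ k × j ≡ l) → ∀ v → v ∈ between (half (toℕ i)) (half (toℕ j)) →
                           ¬ v ∈ between (half (toℕ k)) (half (toℕ l))
      interiors-disjoint i j k l i<j eij k<l ekl ij≢kl v v∈ v∈′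
        with half (toℕ i) in hi | half (toℕ k) in hk | flowerEdge eij i<j | flowerEdge ekl k<l | inFlower i | inFlower k
      ... | odd q | odd q′ | eᵢⱼ | eₖₗ | q<r | q′<r with same-petal q<r q′<r (there (∈-++⁺ˡ v∈)) (there (∈-++⁺ˡ v∈′))
      ... | refl = ij≢kl (toℕ-injective (half-injective (trans hi (sym hk))) ,
                          toℕ-injective (half-injective (trans (rim-target eᵢⱼ) (sym (rim-target eₖₗ)))))

module CycleChains (G : Graph) where
  open Walks G

  record CycleChain (r : ℕ) : Set where
    field
      joint apex      : ℕ → V
      X Y             : ℕ → List V
      arcX            : ∀ {k} → k < r → Arc (joint k) (joint (suc k)) (apex k ∷ X k)
      arcY            : ∀ {k} → k < r → Arc (joint k) (joint (suc k)) (Y k)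
      unique          : ∀ {k} → k < r → Unique ((apex k ∷ X k) ++ Y k)
      joint∉          : ∀ {k k′} → k ≤ r → k′ < r → joint k ∉ (apex k′ ∷ X k′) ++ Y k′
      joint-injective : ∀ {k k′} → k ≤ r → k′ ≤ r → joint k ≡ joint k′ → k ≡ k′
      disjoint        : ∀ {k k′} → k < r → k′ < r → k ≢ k′ →
                        Disjoint ((apex k ∷ X k) ++ Y k) ((apex k′ ∷ X k′) ++ Y k′)

  module _ {r : ℕ} (C : CycleChain r) where
    open CycleChain C

    inner : ℕ → List V
    inner k = (apex k ∷ X k) ++ Y k

    X⊆inner : ∀ {k v} → v ∈ apex k ∷ X k → v ∈ inner k
    X⊆inner = ∈-++⁺ˡ

    Y⊆inner : ∀ {k v} → v ∈ Y k → v ∈ inner k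
    Y⊆inner {k} = ∈-++⁺ʳ (apex k ∷ X k)

    same-block : ∀ {k k′ v} → k < r → k′ < r → v ∈ inner k → v ∈ inner k′ → k ≡ k′
    same-block {k} {k′} k<r k′<r v∈ v∈′ with k ≟ℕ k′
    ... | yes k≡k′ = k≡k′
    ... | no k≢k′  = ⊥-elim (disjoint k<r k′<r k≢k′ (v∈ , v∈′))

    block : ∀ {k} → k < r → ArcPair (joint k) (joint (suc k))
    block {k} k<r = record
      { X = apex k ∷ X k ; Y = Y k ; arcX = arcX k<r ; arcY = arcY k<r
      ; unique-X = Unique-++⁻ˡ (apex k ∷ X k) (unique k<r) ; unique-Y = Unique-++⁻ʳ (apex k ∷ X k) (unique k<r)
      ; disjoint = Unique-++⇒Disjoint (apex k ∷ X k) (unique k<r)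
      ; s≢t = λ eq → 1+n≢n (sym (joint-injective (<⇒≤ k<r) k<r eq))
      ; s∉X = joint∉ (<⇒≤ k<r) k<r ∘ X⊆inner ; s∉Y = joint∉ (<⇒≤ k<r) k<r ∘ Y⊆inner
      ; t∉X = joint∉ k<r k<r ∘ X⊆inner ; t∉Y = joint∉ k<r k<r ∘ Y⊆inner
      ; X-nonempty = s≤s z≤n }

    block-∈ : ∀ {k v} (k<r : k < r) → v ∈ cycle (block k<r) → v ≡ joint k ⊎ v ≡ joint (suc k) ⊎ v ∈ inner k
    block-∈ k<r v∈ with cycle-∈ (block k<r) v∈
    ... | inj₁ v≡                      = inj₁ v≡
    ... | inj₂ (inj₁ v≡)               = inj₂ (inj₁ v≡)
    ... | inj₂ (inj₂ (inj₁ v∈X))       = inj₂ (inj₂ (X⊆inner v∈X))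
    ... | inj₂ (inj₂ (inj₂ v∈Y))       = inj₂ (inj₂ (Y⊆inner v∈Y))

    joint-in-block : ∀ {k j v} (k<r : k < r) → j ≤ r → v ≡ joint j → v ∈ cycle (block k<r) → j ≡ k ⊎ j ≡ suc k
    joint-in-block {k} {j} k<r j≤r refl v∈ with block-∈ k<r v∈
    ... | inj₁ eq         = inj₁ (joint-injective j≤r (<⇒≤ k<r) eq)
    ... | inj₂ (inj₁ eq)  = inj₂ (joint-injective j≤r k<r eq)
    ... | inj₂ (inj₂ j∈)  = ⊥-elim (joint∉ j≤r k<r j∈)

    shared-joint : ∀ {k k′ v} (k<r : k < r) (k′<r : k′ < r) → k ≢ k′ → v ∈ cycle (block k<r) → v ∈ cycle (block k′<r) →
                   Σ ℕ λ j → v ≡ joint j × (j ≡ k ⊎ j ≡ suc k) × (j ≡ k′ ⊎ j ≡ suc k′)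
    shared-joint {k} {k′} k<r k′<r k≢k′ v∈ v∈′ with block-∈ k<r v∈
    ... | inj₁ refl        = k , refl , inj₁ refl , joint-in-block k′<r (<⇒≤ k<r) refl v∈′
    ... | inj₂ (inj₁ refl) = suc k , refl , inj₂ refl , joint-in-block k′<r k<r refl v∈′
    ... | inj₂ (inj₂ v∈I) with block-∈ k′<r v∈′
    ...   | inj₁ refl        = ⊥-elim (joint∉ (<⇒≤ k′<r) k<r v∈I)
    ...   | inj₂ (inj₁ refl) = ⊥-elim (joint∉ k′<r k<r v∈I)
    ...   | inj₂ (inj₂ v∈I′) = ⊥-elim (k≢k′ (same-block k<r k′<r v∈I v∈I′))

    hasCycleChain : HasCycleChain r G
    hasCycleChain = (λ i → cycle (block (toℕ<n i))) , (λ i → cycle-isCycle (block (toℕ<n i))) , consecutive , apart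
      where
      ends : ∀ {j k} → j ≡ k ⊎ j ≡ suc k → k ≤ j × j ≤ suc k
      ends (inj₁ refl) = ≤-refl , n≤1+n _
      ends (inj₂ refl) = n≤1+n _ , ≤-refl

      consecutive : ∀ i j → toℕ j ≡ suc (toℕ i) →
                    Σ V λ v → v ∈ cycle (block (toℕ<n i)) × v ∈ cycle (block (toℕ<n j)) ×
                              (∀ w → w ∈ cycle (block (toℕ<n i)) → w ∈ cycle (block (toℕ<n j)) → w ≡ v)
      consecutive i j j≡ = joint (suc (toℕ i)) , t∈cycle (block (toℕ<n i)) , here (cong joint (sym j≡)) , only
        where
        only : ∀ w → w ∈ cycle (block (toℕ<n i)) → w ∈ cycle (block (toℕ<n j)) → w ≡ joint (suc (toℕ i))
        only w w∈ w∈′ with j′ , refl , at-i , at-j ← shared-joint (toℕ<n i) (toℕ<n j) (λ eq → 1+n≢n (sym (trans eq j≡))) w∈ w∈′ =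
          cong joint (≤-antisym (proj₂ (ends at-i)) (subst (_≤ j′) j≡ (proj₁ (ends at-j))))

      apart : ∀ i j → 2 + toℕ i ≤ toℕ j → ∀ v → v ∈ cycle (block (toℕ<n i)) → ¬ v ∈ cycle (block (toℕ<n j))
      apart i j 2+i≤j v v∈ v∈′
        with j′ , _ , at-i , at-j ← shared-joint (toℕ<n i) (toℕ<n j) (<⇒≢ (≤-trans (n≤1+n _) 2+i≤j)) v∈ v∈′ =
        1+n≰n (≤-trans 2+i≤j (≤-trans (proj₁ (ends at-j)) (proj₂ (ends at-i))))

    -- Vertex 2k is joint k and vertex 2k+1 is apex k.
    vertex : Half → V
    vertex (even k) = joint k
    vertex (odd k)  = apex k

    InChain : Half → Set
    InChain (even k) = k ≤ r
    InChain (odd k)  = k < r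

    inChain : (i : Fin (suc (2 * r))) → InChain (half (toℕ i))
    inChain i with half (toℕ i) in eq
    ... | even k = half-even-≤ (≤-pred (toℕ<n i)) eq
    ... | odd k  = half-odd-< (≤-pred (toℕ<n i)) eq

    vertex-injective : ∀ {h h′} → InChain h → InChain h′ → vertex h ≡ vertex h′ → h ≡ h′
    vertex-injective {even k} {even k′} k≤r k′≤r eq = cong even (joint-injective k≤r k′≤r eq)
    vertex-injective {even k} {odd k′}  k≤r k′<r eq = ⊥-elim (joint∉ k≤r k′<r (here eq))
    vertex-injective {odd k}  {even k′} k<r k′≤r eq = ⊥-elim (joint∉ k′≤r k<r (here (sym eq)))
    vertex-injective {odd k}  {odd k′}  k<r k′<r eq = cong odd (same-block k<r k′<r (here refl) (here eq))

    apex∉ : ∀ {k} → k < r → apex k ∉ X k ++ Y k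
    apex∉ k<r = Unique-∷⇒∉ (unique k<r)

    X#Y : ∀ {k} → k < r → Disjoint (X k) (Y k)
    X#Y {k} k<r with unique k<r
    ... | _ ∷ u = Unique-++⇒Disjoint (X k) u

    between : Half → Half → List V
    between (odd k)  _        = X k
    between (even k) (even _) = Y k
    between (even _) (odd _)  = []

    data ChainEdge (h h′ : Half) : Set where
      rung  : ∀ k → h ≡ even k → h′ ≡ odd k        → ChainEdge h h′
      slant : ∀ k → h ≡ odd k  → h′ ≡ even (suc k) → ChainEdge h h′
      base  : ∀ k → h ≡ even k → h′ ≡ even (suc k) → ChainEdge h h′

    successor-edge : ∀ x y → half y ≡ successor (half x) → ChainEdge (half x) (half y)
    successor-edge x y eq with half x
    ... | even k = rung k refl eq
    ... | odd k  = slant k refl eq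

    chainEdge : ∀ {i j : Fin (suc (2 * r))} → Edge (TriChain r) i j → toℕ i < toℕ j →
                ChainEdge (half (toℕ i)) (half (toℕ j))
    chainEdge {i} {j} e i<j with fromRel-edge (suc (2 * r)) i j e
    ... | inj₁ t with to T-∨ t
    ...   | inj₁ s = successor-edge (toℕ i) (toℕ j) (trans (cong half (≡ᵇ⇒≡ (toℕ j) _ s)) (half-suc (toℕ i)))
    ...   | inj₂ s with k , eq ← half-even (toℕ i) (proj₁ (to T-∧ s)) =
      base k eq (trans (cong half (≡ᵇ⇒≡ (toℕ j) _ (proj₂ (to T-∧ s)))) (cong next eq))
    chainEdge {i} {j} e i<j | inj₂ t with to T-∨ t
    ...   | inj₁ s = ⊥-elim (<-asym i<j (≤-reflexive (sym (≡ᵇ⇒≡ (toℕ i) _ s))))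
    ...   | inj₂ s = ⊥-elim (<-asym i<j (≤-trans (n≤1+n _) (≤-reflexive (sym (≡ᵇ⇒≡ (toℕ i) _ (proj₂ (to T-∧ s)))))))

    edge-path : ∀ {h h′} → ChainEdge h h′ → InChain h → InChain h′ → IsPath G (vertex h ∷ between h h′ ++ [ vertex h′ ])
    edge-path (rung k refl refl) _ k<r =
      Unique-ends [] (λ ()) (λ ()) (joint∉ (<⇒≤ k<r) k<r ∘ here) , arc-head (arcX k<r) ∷ [-]
    edge-path (slant k refl refl) k<r _ with unique k<r
    ... | _ ∷ u = arc⇒IsPath (arc-tail (arcX k<r)) (Unique-++⁻ˡ (X k) u) (apex∉ k<r ∘ ∈-++⁺ˡ)
                             (joint∉ k<r k<r ∘ there ∘ ∈-++⁺ˡ) (joint∉ k<r k<r ∘ here ∘ sym)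
    edge-path (base k refl refl) _ k<r = arc⇒IsPath (arcY k<r) unique-Y s∉Y t∉Y s≢t
      where open ArcPair (block k<r) using (unique-Y; s∉Y; t∉Y; s≢t)

    tail-avoids : ∀ {k v h} → k < r → v ∈ X k ++ Y k → InChain h → v ≢ vertex h
    tail-avoids {h = even k′} k<r v∈ k′≤r refl = joint∉ k′≤r k<r (there v∈)
    tail-avoids {h = odd k′}  k<r v∈ k′<r refl with refl ← same-block k<r k′<r (there v∈) (here refl) = apex∉ k<r v∈

    between-avoids : ∀ {h h′ v h″} → ChainEdge h h′ → InChain h → InChain h′ → v ∈ between h h′ →
                     InChain h″ → v ≢ vertex h″
    between-avoids (rung k refl refl) _ _ ()
    between-avoids (slant k refl refl) k<r _ v∈ = tail-avoids k<r (∈-++⁺ˡ v∈)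
    between-avoids {v = v} (base k refl refl) _ k<r v∈ = tail-avoids k<r (∈-++⁺ʳ (X k) v∈)

    between-determines-edge : ∀ {h₁ h₁′ h₂ h₂′ v} → ChainEdge h₁ h₁′ → ChainEdge h₂ h₂′ →
                              InChain h₁ → InChain h₁′ → InChain h₂ → InChain h₂′ →
                              v ∈ between h₁ h₁′ → v ∈ between h₂ h₂′ → h₁ ≡ h₂ × h₁′ ≡ h₂′
    between-determines-edge (rung k refl refl) _ _ _ _ _ () _
    between-determines-edge _ (rung k refl refl) _ _ _ _ _ ()
    between-determines-edge (slant k refl refl) (slant k′ refl refl) k<r _ k′<r _ v∈ v∈′
      with refl ← same-block k<r k′<r (there (∈-++⁺ˡ v∈)) (there (∈-++⁺ˡ v∈′)) = refl , refl
    between-determines-edge (base k refl refl) (base k′ refl refl) _ k<r _ k′<r v∈ v∈′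
      with refl ← same-block k<r k′<r (Y⊆inner v∈) (Y⊆inner v∈′) = refl , refl
    between-determines-edge (slant k refl refl) (base k′ refl refl) k<r _ _ k′<r v∈ v∈′
      with refl ← same-block k<r k′<r (there (∈-++⁺ˡ v∈)) (Y⊆inner v∈′) = ⊥-elim (X#Y k<r (v∈ , v∈′))
    between-determines-edge (base k refl refl) (slant k′ refl refl) _ k<r k′<r _ v∈ v∈′
      with refl ← same-block k<r k′<r (Y⊆inner v∈) (there (∈-++⁺ˡ v∈′)) = ⊥-elim (X#Y k<r (v∈′ , v∈))

    TriChain-topMinor : TopMinor (TriChain r) G
    TriChain-topMinor = vertex ∘ half ∘ toℕ , (λ i j → between (half (toℕ i)) (half (toℕ j))) ,
      (λ i j eq → toℕ-injective (half-injective (vertex-injective (inChain i) (inChain j) eq))) , paths , interiors-disjoint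
      where
      paths : ∀ i j → toℕ i < toℕ j → Edge (TriChain r) i j →
              IsPath G (vertex (half (toℕ i)) ∷ between (half (toℕ i)) (half (toℕ j)) ++ [ vertex (half (toℕ j)) ]) ×
              (∀ v → v ∈ between (half (toℕ i)) (half (toℕ j)) → ∀ k → ¬ v ≡ vertex (half (toℕ k)))
      paths i j i<j e = edge-path (chainEdge e i<j) (inChain i) (inChain j) ,
                        λ v v∈ k → between-avoids (chainEdge e i<j) (inChain i) (inChain j) v∈ (inChain k)

      interiors-disjoint : ∀ i j k l → toℕ i < toℕ j → Edge (TriChain r) i j → toℕ k < toℕ l → Edge (TriChain r) k l →
                           ¬ (i ≡ k × j ≡ l) → ∀ v → v ∈ between (half (toℕ i)) (half (toℕ j)) →
                           ¬ v ∈ between (half (toℕ k)) (half (toℕ l))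
      interiors-disjoint i j k l i<j eij k<l ekl ij≢kl v v∈ v∈′
        with hi≡hk , hj≡hl ← between-determines-edge (chainEdge eij i<j) (chainEdge ekl k<l)
                               (inChain i) (inChain j) (inChain k) (inChain l) v∈ v∈′ =
        ij≢kl (toℕ-injective (half-injective hi≡hk) , toℕ-injective (half-injective hj≡hl))

module LongCycles (G : Graph) where
  open Walks G

  data CycleEdge (r a b : ℕ) : Set where
    consecutive : b ≡ suc a → CycleEdge r a b
    closing     : a ≡ 0 → suc b ≡ r → CycleEdge r a b

  cycleEdge : ∀ {r} {i j : Fin r} → Edge (CycleGraph r) i j → toℕ i < toℕ j → CycleEdge r (toℕ i) (toℕ j)
  cycleEdge {r} {i} {j} e i<j with fromRel-edge r i j e
  ... | inj₁ t with to T-∨ t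
  ...   | inj₁ s = consecutive (≡ᵇ⇒≡ (toℕ j) _ s)
  ...   | inj₂ s = ⊥-elim (<⇒≢ (≤-trans (s≤s z≤n) i<j) (sym (≡ᵇ⇒≡ (toℕ j) 0 (proj₂ (to T-∧ s)))))
  cycleEdge {r} {i} {j} e i<j | inj₂ t with to T-∨ t
  ...   | inj₁ s = ⊥-elim (<-asym i<j (≤-reflexive (sym (≡ᵇ⇒≡ (toℕ i) _ s))))
  ...   | inj₂ s = closing (≡ᵇ⇒≡ (toℕ i) 0 (proj₂ (to T-∧ s))) (≡ᵇ⇒≡ (suc (toℕ j)) r (proj₁ (to T-∧ s)))

  -- The cycle x ∷ F ++ f ∷ D is cut after its first r vertices x ∷ F ++ [ f ]; these are the
  -- branch vertices, and the rest D subdivides the edge between vertex r - 1 and vertex 0.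
  module _ {r x f} (3≤r : 3 ≤ r) (F D : List V) (closed : Arc x x (F ++ f ∷ D)) (unique : Unique (x ∷ F ++ f ∷ D))
           (length-F : 2 + length F ≡ r) where

    prefix : List V
    prefix = x ∷ F ++ [ f ]

    prefix++D : x ∷ F ++ f ∷ D ≡ prefix ++ D
    prefix++D = cong (x ∷_) (sym (++-assoc F [ f ] D))

    prefix-unique : Unique prefix
    prefix-unique = Unique-++⁻ˡ prefix (subst Unique prefix++D unique)

    prefix#D : Disjoint prefix D
    prefix#D = Unique-++⇒Disjoint prefix (subst Unique prefix++D unique)

    length-prefix : length prefix ≡ r
    length-prefix = trans (cong suc (trans (length-++ F) (+-comm (length F) 1))) length-F

    branch : ℕ → V
    branch = lookupOr x prefix

    interior : ℕ → ℕ → List V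
    interior zero (suc (suc _)) = reverse D
    interior _    _             = []

    branch-∈ : ∀ {k} → k < r → branch k ∈ prefix
    branch-∈ k<r = lookupOr-∈ x prefix (subst (_ <_) (sym length-prefix) k<r)

    branch-injective : ∀ {k k′} → k < r → k′ < r → branch k ≡ branch k′ → k ≡ k′
    branch-injective k<r k′<r =
      lookupOr-injective x prefix-unique (subst (_ <_) (sym length-prefix) k<r) (subst (_ <_) (sym length-prefix) k′<r)

    consecutive-path : ∀ k → suc k < r → IsPath G (branch k ∷ interior k (suc k) ++ [ branch (suc k) ])
    consecutive-path k sk<r = subst (λ zs → IsPath G (branch k ∷ zs ++ [ branch (suc k) ])) (sym (no-interior k)) path
      where
      no-interior : ∀ k → interior k (suc k) ≡ []
      no-interior zero    = refl
      no-interior (suc k) = refl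
      path : IsPath G (branch k ∷ [] ++ [ branch (suc k) ])
      path =
        Unique-ends [] (λ ()) (λ ()) (λ eq → 1+n≢n (sym (branch-injective (<-trans (n<1+n k) sk<r) sk<r eq))) ,
        lookupOr-Linked x (Walk⇒Linked (proj₁ (arc-split F f D closed))) (subst (_ <_) (sym length-prefix) sk<r) ∷ [-]

    last-branch : ∀ {b} → suc b ≡ r → branch b ≡ f
    last-branch sb≡r = subst (λ k → branch k ≡ f) (suc-injective (trans length-F (sym sb≡r))) (lookupOr-last x F f)

    closing-path : ∀ {b} → suc b ≡ r → IsPath G (branch 0 ∷ interior 0 b ++ [ branch b ])
    closing-path sb≡r with ≤-pred (subst (3 ≤_) (sym sb≡r) 3≤r)
    ... | s≤s (s≤s _) = subst (λ v → IsPath G (x ∷ reverse D ++ [ v ])) (sym (last-branch sb≡r))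
      (arc⇒IsPath (arc-reverse (proj₂ (arc-split F f D closed))) (Unique-reverse (Unique-++⁻ʳ prefix (subst Unique prefix++D unique)))
                  (λ x∈ → prefix#D (here refl , Any.reverse⁻ x∈))
                  (λ f∈ → prefix#D (there (∈-++⁺ʳ F (here refl)) , Any.reverse⁻ f∈))
                  (λ x≡f → Unique-∷⇒∉ prefix-unique (subst (_∈ F ++ [ f ]) (sym x≡f) (∈-++⁺ʳ F (here refl)))))

    interior-∈ : ∀ a b {v} → v ∈ interior a b → a ≡ 0 × 2 ≤ b × v ∈ D
    interior-∈ zero (suc (suc _)) v∈ = refl , s≤s (s≤s z≤n) , Any.reverse⁻ v∈

    closing-target : ∀ {a b} → CycleEdge r a b → a ≡ 0 → 2 ≤ b → suc b ≡ r
    closing-target (consecutive refl) refl (s≤s ())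
    closing-target (closing _ sb≡r)   _    _ = sb≡r

    cyclePrefix-topMinor : TopMinor (CycleGraph r) G
    cyclePrefix-topMinor = branch ∘ toℕ , (λ i j → interior (toℕ i) (toℕ j)) ,
      (λ i j eq → toℕ-injective (branch-injective (toℕ<n i) (toℕ<n j) eq)) , paths , interiors-disjoint
      where
      paths : ∀ i j → toℕ i < toℕ j → Edge (CycleGraph r) i j →
              IsPath G (branch (toℕ i) ∷ interior (toℕ i) (toℕ j) ++ [ branch (toℕ j) ]) ×
              (∀ v → v ∈ interior (toℕ i) (toℕ j) → ∀ k → ¬ v ≡ branch (toℕ k))
      paths i j i<j e = path (cycleEdge e i<j) , avoids
        where
        path : CycleEdge r (toℕ i) (toℕ j) → IsPath G (branch (toℕ i) ∷ interior (toℕ i) (toℕ j) ++ [ branch (toℕ j) ])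
        path (consecutive j≡) = subst (λ b → IsPath G (branch (toℕ i) ∷ interior (toℕ i) b ++ [ branch b ])) (sym j≡)
                                      (consecutive-path (toℕ i) (subst (_< r) j≡ (toℕ<n j)))
        path (closing i≡0 sj≡r) = subst (λ a → IsPath G (branch a ∷ interior a (toℕ j) ++ [ branch (toℕ j) ])) (sym i≡0)
                                        (closing-path sj≡r)
        avoids : ∀ v → v ∈ interior (toℕ i) (toℕ j) → ∀ k → ¬ v ≡ branch (toℕ k)
        avoids v v∈ k v≡ with _ , _ , v∈D ← interior-∈ (toℕ i) (toℕ j) v∈ =
          prefix#D (subst (_∈ prefix) (sym v≡) (branch-∈ (toℕ<n k)) , v∈D)

      interiors-disjoint : ∀ i j k l → toℕ i < toℕ j → Edge (CycleGraph r) i j → toℕ k < toℕ l → Edge (CycleGraph r) k l →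
                           ¬ (i ≡ k × j ≡ l) → ∀ v → v ∈ interior (toℕ i) (toℕ j) → ¬ v ∈ interior (toℕ k) (toℕ l)
      interiors-disjoint i j k l i<j eij k<l ekl ij≢kl v v∈ v∈′
        with i≡0 , 2≤j , _ ← interior-∈ (toℕ i) (toℕ j) v∈ | k≡0 , 2≤l , _ ← interior-∈ (toℕ k) (toℕ l) v∈′ =
        ij≢kl (toℕ-injective (trans i≡0 (sym k≡0)) ,
               toℕ-injective (suc-injective (trans (closing-target (cycleEdge eij i<j) i≡0 2≤j)
                                                   (sym (closing-target (cycleEdge ekl k<l) k≡0 2≤l)))))

  cycle-topMinor : ∀ {r x W} → 3 ≤ r → Arc x x W → Unique (x ∷ W) → r ≤ length (x ∷ W) → TopMinor (CycleGraph r) G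
  cycle-topMinor {W = W} 3≤r@(s≤s (s≤s (s≤s {n = r′} _))) closed unique r≤
    with F , f , D , refl , length-F ← split-at (suc r′) W (≤-pred r≤) =
    cyclePrefix-topMinor 3≤r F D closed unique (cong (2 +_) length-F)

  record LongCycle (r : ℕ) : Set where
    field
      {s t}  : V
      arcs   : ArcPair s t
      long   : r ≤ length (cycle arcs)

  module _ {r : ℕ} (L : LongCycle r) where
    open LongCycle L

    hasLongCycle : HasLongCycle r G
    hasLongCycle = cycle arcs , cycle-isCycle arcs , long

    CycleGraph-topMinor : 3 ≤ r → TopMinor (CycleGraph r) G
    CycleGraph-topMinor 3≤r =
      cycle-topMinor 3≤r (arc-++ (ArcPair.arcX arcs) (arc-reverse (ArcPair.arcY arcs))) (proj₁ (proj₂ (cycle-isCycle arcs))) long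

iterate-+ : ∀ {A : Set} (f : A → A) v a b → iterate f v (a + b) ≡ iterate f (iterate f v a) b
iterate-+ f v zero    b = refl
iterate-+ f v (suc a) b = iterate-+ f (f v) a b

iterate-suc : ∀ {A : Set} (f : A → A) v k → iterate f v (suc k) ≡ f (iterate f v k)
iterate-suc f v zero    = refl
iterate-suc f v (suc k) = iterate-suc f (f v) k

iterate-fixed : ∀ {A : Set} (f : A → A) {v} k → f v ≡ v → iterate f v k ≡ v
iterate-fixed f zero    fv≡v = refl
iterate-fixed f (suc k) fv≡v = trans (cong (λ w → iterate f w k) fv≡v) (iterate-fixed f k fv≡v)

Ancestor : {A : Set} → (A → A) → A → A → Set
Ancestor parent a v = Σ ℕ λ k → iterate parent v k ≡ a

record NormalSpanningTree (G : Graph) (root : Vtx G) : Set where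
  field
    parent       : Vtx G → Vtx G
    depth        : Vtx G → ℕ
    parent-root  : parent root ≡ root
    depth-root   : depth root ≡ 0
    depth-parent : ∀ {v} → v ≢ root → depth v ≡ suc (depth (parent v))
    edge-parent  : ∀ {v} → v ≢ root → Edge G v (parent v)
    normal       : ∀ {u v} → Edge G u v → Ancestor parent u v ⊎ Ancestor parent v u

module DepthFirstSearch (G : Graph) (root : Vtx G) where
  open Walks G
  open import Data.List.Membership.DecPropositional (_≟_ {n G}) using (_∈?_)

  -- frontier is the invariant of depth-first search that makes every edge of G join a vertex to
  -- one of its ancestors in the final tree.
  record State : Set where
    field
      visited        : List V
      parent         : V → V
      depth          : V → ℕ
      current        : V
      visited-unique : Unique visited
      root∈          : root ∈ visited
      current∈       : current ∈ visited
      parent-root    : parent root ≡ root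
      depth-root     : depth root ≡ 0
      parent∈        : ∀ {v} → v ∈ visited → parent v ∈ visited
      depth-parent   : ∀ {v} → v ∈ visited → v ≢ root → depth v ≡ suc (depth (parent v))
      edge-parent    : ∀ {v} → v ∈ visited → v ≢ root → Edge G v (parent v)
      normal         : ∀ {u v} → u ∈ visited → v ∈ visited → Edge G u v → Ancestor parent u v ⊎ Ancestor parent v u
      frontier       : ∀ {x y} → x ∈ visited → y ∉ visited → Edge G x y → Ancestor parent x current

  no-loop : ∀ {v} → ¬ Edge G v v
  no-loop {v} e with () ← trans (sym (adj-irr G v)) e

  start : State
  start = record
    { visited = [ root ] ; parent = λ _ → root ; depth = λ _ → 0 ; current = root
    ; visited-unique = Unique-[ root ] ; root∈ = here refl ; current∈ = here refl
    ; parent-root = refl ; depth-root = refl ; parent∈ = λ _ → here refl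
    ; depth-parent = λ { (here refl) v≢root → ⊥-elim (v≢root refl) }
    ; edge-parent  = λ { (here refl) v≢root → ⊥-elim (v≢root refl) }
    ; normal       = λ { (here refl) (here refl) e → ⊥-elim (no-loop e) }
    ; frontier     = λ { (here refl) _ _ → 0 , refl } }

  advance : (s : State) (y : V) → Edge G (State.current s) y → y ∉ State.visited s → State
  advance s y e y∉ = record
    { visited = y ∷ visited ; parent = parent′ ; depth = depth′ ; current = y
    ; visited-unique = Unique-∷ y∉ visited-unique ; root∈ = there root∈ ; current∈ = here refl
    ; parent-root = trans (updateAt-minimal root y parent (old root∈)) parent-root
    ; depth-root = trans (updateAt-minimal root y depth (old root∈)) depth-root
    ; parent∈ = parent∈′ ; depth-parent = depth-parent′ ; edge-parent = edge-parent′ ; normal = normal′ ; frontier = frontier′ }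
    where
    open State s
    parent′ : V → V
    parent′ = updateAt parent y (const current)
    depth′ : V → ℕ
    depth′ = updateAt depth y (const (suc (depth current)))
    old : ∀ {w} → w ∈ visited → w ≢ y
    old w∈ refl = y∉ w∈
    iterate-agrees : ∀ k {w} → w ∈ visited → iterate parent′ w k ≡ iterate parent w k
    iterate-agrees zero    w∈ = refl
    iterate-agrees (suc k) {w} w∈ =
      trans (cong (λ z → iterate parent′ z k) (updateAt-minimal w y parent (old w∈))) (iterate-agrees k (parent∈ w∈))
    ancestor-old : ∀ {a w} → w ∈ visited → Ancestor parent a w → Ancestor parent′ a w
    ancestor-old w∈ (k , eq) = k , trans (iterate-agrees k w∈) eq
    ancestor-y : ∀ {a} → Ancestor parent a current → Ancestor parent′ a y
    ancestor-y (k , eq) = suc k , trans (cong (λ z → iterate parent′ z k) (updateAt-updates y parent))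
                                        (trans (iterate-agrees k current∈) eq)
    parent∈′ : ∀ {w} → w ∈ y ∷ visited → parent′ w ∈ y ∷ visited
    parent∈′ (here refl) = subst (_∈ y ∷ visited) (sym (updateAt-updates y parent)) (there current∈)
    parent∈′ {w} (there w∈) = subst (_∈ y ∷ visited) (sym (updateAt-minimal w y parent (old w∈))) (there (parent∈ w∈))
    depth-parent′ : ∀ {w} → w ∈ y ∷ visited → w ≢ root → depth′ w ≡ suc (depth′ (parent′ w))
    depth-parent′ (here refl) _ = begin
      depth′ y                  ≡⟨ updateAt-updates y depth ⟩
      suc (depth current)       ≡⟨ cong suc (sym (updateAt-minimal current y depth (old current∈))) ⟩
      suc (depth′ current)      ≡⟨ cong (suc ∘ depth′) (sym (updateAt-updates y parent)) ⟩
      suc (depth′ (parent′ y))  ∎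
      where open ≡-Reasoning
    depth-parent′ {w} (there w∈) w≢root = begin
      depth′ w                  ≡⟨ updateAt-minimal w y depth (old w∈) ⟩
      depth w                   ≡⟨ depth-parent w∈ w≢root ⟩
      suc (depth (parent w))    ≡⟨ cong suc (sym (updateAt-minimal (parent w) y depth (old (parent∈ w∈)))) ⟩
      suc (depth′ (parent w))   ≡⟨ cong (suc ∘ depth′) (sym (updateAt-minimal w y parent (old w∈))) ⟩
      suc (depth′ (parent′ w))  ∎
      where open ≡-Reasoning
    edge-parent′ : ∀ {w} → w ∈ y ∷ visited → w ≢ root → Edge G w (parent′ w)
    edge-parent′ (here refl) _ = subst (Edge G y) (sym (updateAt-updates y parent)) (edge-sym e)
    edge-parent′ {w} (there w∈) w≢root = subst (Edge G w) (sym (updateAt-minimal w y parent (old w∈))) (edge-parent w∈ w≢root)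
    normal′ : ∀ {u v} → u ∈ y ∷ visited → v ∈ y ∷ visited → Edge G u v → Ancestor parent′ u v ⊎ Ancestor parent′ v u
    normal′ (here refl) (here refl) e′ = ⊥-elim (no-loop e′)
    normal′ (here refl) (there v∈)  e′ = inj₂ (ancestor-y (frontier v∈ y∉ (edge-sym e′)))
    normal′ (there u∈)  (here refl) e′ = inj₁ (ancestor-y (frontier u∈ y∉ e′))
    normal′ (there u∈)  (there v∈)  e′ with normal u∈ v∈ e′
    ... | inj₁ anc = inj₁ (ancestor-old v∈ anc)
    ... | inj₂ anc = inj₂ (ancestor-old u∈ anc)
    frontier′ : ∀ {x z} → x ∈ y ∷ visited → z ∉ y ∷ visited → Edge G x z → Ancestor parent′ x y
    frontier′ (here refl) _  _  = 0 , refl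
    frontier′ (there x∈)  z∉ e′ = ancestor-y (frontier x∈ (z∉ ∘ there) e′)

  Exhausted : State → Set
  Exhausted s = ∀ y → Edge G (State.current s) y → y ∈ State.visited s

  retreat : (s : State) → Exhausted s → State.current s ≢ root → State
  retreat s exhausted current≢root = record
    { visited = visited ; parent = parent ; depth = depth ; current = parent current
    ; visited-unique = visited-unique ; root∈ = root∈ ; current∈ = parent∈ current∈
    ; parent-root = parent-root ; depth-root = depth-root ; parent∈ = parent∈ ; depth-parent = depth-parent
    ; edge-parent = edge-parent ; normal = normal ; frontier = frontier′ }
    where
    open State s
    frontier′ : ∀ {x z} → x ∈ visited → z ∉ visited → Edge G x z → Ancestor parent x (parent current)
    frontier′ x∈ z∉ e with frontier x∈ z∉ e
    ... | zero  , refl = ⊥-elim (z∉ (exhausted _ e))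
    ... | suc k , eq   = k , eq

  finish : Connected G → (s : State) → Exhausted s → State.current s ≡ root → NormalSpanningTree G root
  finish connected s exhausted current≡root = record
    { parent = parent ; depth = depth ; parent-root = parent-root ; depth-root = depth-root
    ; depth-parent = depth-parent (all-visited _) ; edge-parent = edge-parent (all-visited _)
    ; normal = normal (all-visited _) (all-visited _) }
    where
    open State s
    reach : ∀ {a v} → a ∈ visited → Star (Edge G) a v → v ∈ visited
    reach a∈ ε = a∈
    reach {a} a∈ (_◅_ {j = b} e path) with b ∈? visited
    ... | yes b∈ = reach b∈ path
    ... | no b∉ with k , eq ← frontier a∈ b∉ e = ⊥-elim (b∉ (exhausted b (subst (λ z → Edge G z b) a≡current e)))
      where
      a≡current : a ≡ current
      a≡current = trans (sym eq) (trans (cong (λ z → iterate parent z k) current≡root)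
                                        (trans (iterate-fixed parent k parent-root) (sym current≡root)))
    all-visited : ∀ v → v ∈ visited
    all-visited v = reach root∈ (connected root v)

  -- Advancing lowers the first summand by 2 and raises the second by 1; retreating lowers the second.
  measure : State → ℕ
  measure s = 2 * (n G ∸ length (State.visited s)) + State.depth s (State.current s)

  measure-advance : ∀ s y e y∉ → measure (advance s y e y∉) < measure s
  measure-advance s y e y∉ = ≤-reflexive (begin
    suc (2 * m + depth′ y)         ≡⟨ cong (λ d → suc (2 * m + d)) (updateAt-updates y depth) ⟩
    suc (2 * m + suc d)            ≡⟨ cong suc (+-suc (2 * m) d) ⟩
    2 + 2 * m + d                  ≡⟨ cong (_+ d) (sym (*-suc 2 m)) ⟩
    2 * suc m + d                  ≡⟨ cong (λ k → 2 * k + d) (sym (+-∸-assoc 1 new≤n)) ⟩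
    2 * (n G ∸ length visited) + d ∎)
    where
    open State s
    open ≡-Reasoning
    m d : ℕ
    m = n G ∸ suc (length visited)
    d = depth current
    depth′ : V → ℕ
    depth′ = updateAt depth y (const (suc d))
    new≤n : suc (length visited) ≤ n G
    new≤n = subst (suc (length visited) ≤_) (length-tabulate id)
                  (Unique-⊆⇒length-≤ (Unique-∷ y∉ visited-unique) (λ {v} _ → ∈-allFin v))

  measure-retreat : ∀ s exhausted current≢root → measure (retreat s exhausted current≢root) < measure s
  measure-retreat s _ current≢root =
    subst (λ d → suc (2 * m + depth (parent current)) ≤ 2 * m + d) (sym (depth-parent current∈ current≢root))
          (≤-reflexive (sym (+-suc (2 * m) _)))
    where
    open State s
    m : ℕ
    m = n G ∸ length visited

  advance-or-exhausted : (s : State) → (Σ V λ y → Edge G (State.current s) y × y ∉ State.visited s) ⊎ Exhausted s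
  advance-or-exhausted s with any? (λ y → (adj G (State.current s) y ≟ᵇ true) ×-dec ¬? (y ∈? State.visited s))
  ... | yes found = inj₁ found
  ... | no none   = inj₂ exhausted
    where
    exhausted : Exhausted s
    exhausted y e with y ∈? State.visited s
    ... | yes y∈ = y∈
    ... | no y∉  = ⊥-elim (none (y , e , y∉))

  run : Connected G → (fuel : ℕ) (s : State) → measure s < fuel → NormalSpanningTree G root
  run connected (suc fuel) s m<fuel with advance-or-exhausted s
  ... | inj₁ (y , e , y∉) = run connected fuel (advance s y e y∉) (≤-trans (measure-advance s y e y∉) (≤-pred m<fuel))
  ... | inj₂ exhausted with State.current s ≟ root
  ...   | yes current≡root = finish connected s exhausted current≡root
  ...   | no current≢root  =
    run connected fuel (retreat s exhausted current≢root) (≤-trans (measure-retreat s exhausted current≢root) (≤-pred m<fuel))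

normalSpanningTree : ∀ {G} (root : Vtx G) → Connected G → NormalSpanningTree G root
normalSpanningTree root connected = run connected (suc (measure start)) start ≤-refl
  where open DepthFirstSearch _ root

powerSum : ℕ → ℕ → ℕ
powerSum D zero    = 0
powerSum D (suc K) = D ^ K + powerSum D K

module NormalTrees {G : Graph} {root : Vtx G} (tree : NormalSpanningTree G root) where
  open Walks G
  open NormalSpanningTree tree

  infix 4 _⊑_ _⊑?_

  _⊑_ : V → V → Set
  a ⊑ v = Ancestor parent a v

  ⊑-refl : ∀ {v} → v ⊑ v
  ⊑-refl = 0 , refl

  ⊑-trans : ∀ {a b c} → a ⊑ b → b ⊑ c → a ⊑ c
  ⊑-trans {c = c} (k₁ , eq₁) (k₂ , eq₂) =
    k₂ + k₁ , trans (iterate-+ parent c k₂ k₁) (trans (cong (λ w → iterate parent w k₁) eq₂) eq₁)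

  parent⊑ : ∀ {v} → parent v ⊑ v
  parent⊑ = 1 , refl

  ⊑-parent : ∀ {a v} → a ⊑ v → a ≢ v → a ⊑ parent v
  ⊑-parent (zero  , eq) a≢v = ⊥-elim (a≢v (sym eq))
  ⊑-parent (suc k , eq) _   = k , eq

  depth-zero⇒root : ∀ {v} → depth v ≡ 0 → v ≡ root
  depth-zero⇒root {v} d≡0 with v ≟ root
  ... | yes v≡root = v≡root
  ... | no v≢root with () ← trans (sym d≡0) (depth-parent v≢root)

  depth-pos⇒≢root : ∀ {v} → 1 ≤ depth v → v ≢ root
  depth-pos⇒≢root 1≤d refl = 1+n≰n (subst (1 ≤_) depth-root 1≤d)

  depth-parent-≤ : ∀ v → depth (parent v) ≤ depth v
  depth-parent-≤ v with v ≟ root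
  ... | yes refl     = ≤-reflexive (cong depth parent-root)
  ... | no v≢root    = ≤-trans (n≤1+n _) (≤-reflexive (sym (depth-parent v≢root)))

  depth-iterate-≤ : ∀ k v → depth (iterate parent v k) ≤ depth v
  depth-iterate-≤ zero    v = ≤-refl
  depth-iterate-≤ (suc k) v = ≤-trans (depth-iterate-≤ k (parent v)) (depth-parent-≤ v)

  depth-iterate : ∀ k v → k ≤ depth v → depth (iterate parent v k) + k ≡ depth v
  depth-iterate zero    v _   = +-identityʳ (depth v)
  depth-iterate (suc k) v k<d = begin
    depth (iterate parent (parent v) k) + suc k ≡⟨ +-suc _ k ⟩
    suc (depth (iterate parent (parent v) k) + k) ≡⟨ cong suc (depth-iterate k (parent v) k≤dp) ⟩
    suc (depth (parent v))                         ≡⟨ sym d≡ ⟩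
    depth v                                        ∎
    where
    open ≡-Reasoning
    d≡ : depth v ≡ suc (depth (parent v))
    d≡ = depth-parent (depth-pos⇒≢root (≤-trans (s≤s z≤n) k<d))
    k≤dp : k ≤ depth (parent v)
    k≤dp = ≤-pred (subst (suc k ≤_) d≡ k<d)

  depth-iterate-∸ : ∀ k v → k ≤ depth v → depth (iterate parent v k) ≡ depth v ∸ k
  depth-iterate-∸ k v k≤d = trans (sym (m+n∸n≡m _ k)) (cong (_∸ k) (depth-iterate k v k≤d))

  iterate-beyond-depth : ∀ k v → depth v ≤ k → iterate parent v k ≡ root
  iterate-beyond-depth k v d≤k = begin
    iterate parent v k                                        ≡⟨ cong (iterate parent v) (sym (m+[n∸m]≡n d≤k)) ⟩
    iterate parent v (depth v + (k ∸ depth v))                ≡⟨ iterate-+ parent v (depth v) (k ∸ depth v) ⟩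
    iterate parent (iterate parent v (depth v)) (k ∸ depth v) ≡⟨ cong (λ w → iterate parent w (k ∸ depth v)) top ⟩
    iterate parent root (k ∸ depth v)                         ≡⟨ iterate-fixed parent (k ∸ depth v) parent-root ⟩
    root                                                      ∎
    where
    open ≡-Reasoning
    top : iterate parent v (depth v) ≡ root
    top = depth-zero⇒root (+-cancelʳ-≡ (depth v) _ 0 (depth-iterate (depth v) v ≤-refl))

  root⊑ : ∀ {v} → root ⊑ v
  root⊑ {v} = depth v , iterate-beyond-depth (depth v) v ≤-refl

  ⊑⇒depth-≤ : ∀ {a v} → a ⊑ v → depth a ≤ depth v
  ⊑⇒depth-≤ {v = v} (k , refl) = depth-iterate-≤ k v

  ⊑-canonical : ∀ {a v} → a ⊑ v → iterate parent v (depth v ∸ depth a) ≡ a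
  ⊑-canonical {a} {v} (k , refl) with k ≤? depth v
  ... | yes k≤d = cong (iterate parent v) (trans (cong (depth v ∸_) (depth-iterate-∸ k v k≤d)) (m∸[m∸n]≡n k≤d))
  ... | no k≰d  = begin
    iterate parent v (depth v ∸ depth (iterate parent v k)) ≡⟨ iterate-beyond-depth _ v (≤-reflexive (sym d∸0)) ⟩
    root                                                    ≡⟨ sym (iterate-beyond-depth k v (<⇒≤ (≰⇒> k≰d))) ⟩
    iterate parent v k                                      ∎
    where
    open ≡-Reasoning
    d∸0 : depth v ∸ depth (iterate parent v k) ≡ depth v
    d∸0 = cong (depth v ∸_) (trans (cong depth (iterate-beyond-depth k v (<⇒≤ (≰⇒> k≰d)))) depth-root)

  ⊑-unique-at-depth : ∀ {a b v} → a ⊑ v → b ⊑ v → depth a ≡ depth b → a ≡ b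
  ⊑-unique-at-depth {v = v} a⊑v b⊑v da≡db =
    trans (sym (⊑-canonical a⊑v)) (trans (cong (λ d → iterate parent v (depth v ∸ d)) da≡db) (⊑-canonical b⊑v))

  ⊑-depth-≡⇒≡ : ∀ {a v} → a ⊑ v → depth a ≡ depth v → a ≡ v
  ⊑-depth-≡⇒≡ a⊑v = ⊑-unique-at-depth a⊑v ⊑-refl

  ⊑-depth-< : ∀ {a v} → a ⊑ v → a ≢ v → depth a < depth v
  ⊑-depth-< a⊑v a≢v with m≤n⇒m<n∨m≡n (⊑⇒depth-≤ a⊑v)
  ... | inj₁ da<dv = da<dv
  ... | inj₂ da≡dv = ⊥-elim (a≢v (⊑-depth-≡⇒≡ a⊑v da≡dv))

  ⊑-by-depth : ∀ {a b v} → a ⊑ v → b ⊑ v → depth a ≤ depth b → a ⊑ b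
  ⊑-by-depth {a} {b} {v} a⊑v b⊑v da≤db = depth b ∸ depth a , (begin
    iterate parent b (depth b ∸ depth a)                                       ≡⟨ cong (λ w → iterate parent w (depth b ∸ depth a)) (sym (⊑-canonical b⊑v)) ⟩
    iterate parent (iterate parent v (depth v ∸ depth b)) (depth b ∸ depth a) ≡⟨ sym (iterate-+ parent v (depth v ∸ depth b) _) ⟩
    iterate parent v ((depth v ∸ depth b) + (depth b ∸ depth a))              ≡⟨ cong (iterate parent v) steps ⟩
    iterate parent v (depth v ∸ depth a)                                       ≡⟨ ⊑-canonical a⊑v ⟩
    a                                                                          ∎)
    where
    open ≡-Reasoning
    steps : (depth v ∸ depth b) + (depth b ∸ depth a) ≡ depth v ∸ depth a
    steps = trans (sym (+-∸-assoc (depth v ∸ depth b) da≤db)) (cong (_∸ depth a) (m∸n+n≡m (⊑⇒depth-≤ b⊑v)))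

  ⊑-comparable : ∀ {a b v} → a ⊑ v → b ⊑ v → a ⊑ b ⊎ b ⊑ a
  ⊑-comparable {a} {b} a⊑v b⊑v with depth a ≤? depth b
  ... | yes da≤db = inj₁ (⊑-by-depth a⊑v b⊑v da≤db)
  ... | no da≰db  = inj₂ (⊑-by-depth b⊑v a⊑v (<⇒≤ (≰⇒> da≰db)))

  _⊑?_ : ∀ a v → Dec (a ⊑ v)
  a ⊑? v with iterate parent v (depth v ∸ depth a) ≟ a
  ... | yes eq  = yes (depth v ∸ depth a , eq)
  ... | no  neq = no (neq ∘ ⊑-canonical)

  up : V → ℕ → List V
  up v zero    = []
  up v (suc k) = parent v ∷ up (parent v) k

  up-arc : ∀ v k → suc k ≤ depth v → Arc v (iterate parent v (suc k)) (up v k)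
  up-arc v zero    k<d = edge-parent (depth-pos⇒≢root k<d) ▸ stop (parent v)
  up-arc v (suc k) k<d = edge-parent v≢root ▸ up-arc (parent v) k (≤-pred (subst (suc (suc k) ≤_) (depth-parent v≢root) k<d))
    where
    v≢root : v ≢ root
    v≢root = depth-pos⇒≢root (≤-trans (s≤s z≤n) k<d)

  up-∈ : ∀ v k {w} → w ∈ up v k → Σ ℕ λ j → 1 ≤ j × j ≤ k × w ≡ iterate parent v j
  up-∈ v (suc k) (here w≡)  = 1 , ≤-refl , s≤s z≤n , w≡
  up-∈ v (suc k) (there w∈) with j , 1≤j , j≤k , w≡ ← up-∈ (parent v) k w∈ = suc j , s≤s z≤n , s≤s j≤k , w≡

  up-snoc : ∀ v k → up v (suc k) ≡ up v k ++ [ iterate parent v (suc k) ]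
  up-snoc v zero    = refl
  up-snoc v (suc k) = cong (parent v ∷_) (up-snoc (parent v) k)

  up-unique : ∀ v k → k ≤ depth v → Unique (v ∷ up v k)
  up-unique v zero    _   = Unique-[ v ]
  up-unique v (suc k) k≤d = Unique-∷ v∉ (up-unique (parent v) k (≤-pred (subst (suc k ≤_) d≡ k≤d)))
    where
    d≡ : depth v ≡ suc (depth (parent v))
    d≡ = depth-parent (depth-pos⇒≢root (≤-trans (s≤s z≤n) k≤d))
    v∉ : v ∉ up v (suc k)
    v∉ v∈ with j , 1≤j , j≤k , v≡ ← up-∈ v (suc k) v∈ =
      <-irrefl (sym (cong depth v≡)) (subst (depth (iterate parent v j) <_) (depth-iterate j v (≤-trans j≤k k≤d)) (m<m+n _ 1≤j))

  up-⊑ : ∀ v k {w} → w ∈ v ∷ up v k → w ⊑ v × iterate parent v k ⊑ w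
  up-⊑ v k (here refl) = ⊑-refl , (k , refl)
  up-⊑ v k (there w∈) with j , _ , j≤k , refl ← up-∈ v k w∈ =
    (j , refl) , (k ∸ j , trans (sym (iterate-+ parent v j (k ∸ j))) (cong (iterate parent v) (m+[n∸m]≡n j≤k)))

  LowEdge : V → V → V → Set
  LowEdge v x y = v ⊑ x × Edge G x y × y ⊑ parent v × ¬ (x ≡ v × y ≡ parent v)

  ⊑root⇒≡root : ∀ {v} → v ⊑ root → v ≡ root
  ⊑root⇒≡root {v} v⊑root =
    ⊑-depth-≡⇒≡ v⊑root (trans (n≤0⇒n≡0 (subst (depth v ≤_) depth-root (⊑⇒depth-≤ v⊑root))) (sym depth-root))

  leaving-subtree : ∀ {v x y} → v ⊑ x → ¬ v ⊑ y → Edge G x y → y ⊑ parent v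
  leaving-subtree v⊑x v⋢y e with normal e
  ... | inj₁ x⊑y = ⊥-elim (v⋢y (⊑-trans v⊑x x⊑y))
  ... | inj₂ y⊑x with ⊑-comparable y⊑x v⊑x
  ...   | inj₁ y⊑v = ⊑-parent y⊑v (λ y≡v → v⋢y (subst (_ ⊑_) (sym y≡v) ⊑-refl))
  ...   | inj₂ v⊑y = ⊥-elim (v⋢y v⊑y)

  leave-subtree : ∀ {v a} → v ≢ root → v ⊑ a → Star (EdgeMinus G v (parent v)) a root →
                  Σ V λ x → Σ V λ y → v ⊑ x × ¬ v ⊑ y × EdgeMinus G v (parent v) x y
  leave-subtree v≢root v⊑a ε = ⊥-elim (v≢root (⊑root⇒≡root v⊑a))
  leave-subtree {v} {a} v≢root v⊑a (_◅_ {j = b} e path) with v ⊑? b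
  ... | yes v⊑b = leave-subtree v≢root v⊑b path
  ... | no v⋢b  = a , b , v⊑a , v⋢b , e

  lowEdge-exists : TwoEdgeConnected G → ∀ {v} → v ≢ root → Σ V λ x → Σ V λ y → LowEdge v x y
  lowEdge-exists (_ , _ , bridgeless) {v} v≢root
    with x , y , v⊑x , v⋢y , e , not-tree-edge ← leave-subtree v≢root ⊑-refl (bridgeless v (parent v) (edge-parent v≢root) v root) =
    x , y , v⊑x , e , leaving-subtree v⊑x v⋢y e , λ (x≡v , y≡pv) → not-tree-edge (inj₁ (x≡v , y≡pv))

  IsChild : V → V → Set
  IsChild u v = v ≢ root × parent v ≡ u

  isChild? : ∀ u → Decidable (IsChild u)
  isChild? u v = ¬? (v ≟ root) ×-dec (parent v ≟ u)

  children : V → List V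
  children u = filter (isChild? u) (allFin (n G))

  children-unique : ∀ u → Unique (children u)
  children-unique u = filter⁺ (isChild? u) (allFin⁺ (n G))

  ∈-children⁻ : ∀ {u c} → c ∈ children u → IsChild u c
  ∈-children⁻ {u} c∈ = proj₂ (∈-filter⁻ (isChild? u) {xs = allFin _} c∈)

  layer : ℕ → List V
  layer zero    = [ root ]
  layer (suc k) = concatMap children (layer k)

  layer-∈ : ∀ {v} k → depth v ≡ k → v ∈ layer k
  layer-∈ zero    d≡0 = here (depth-zero⇒root d≡0)
  layer-∈ {v} (suc k) d≡ =
    ∈-concat⁺′ (∈-filter⁺ (isChild? (parent v)) (∈-allFin v) (v≢root , refl)) (∈-map⁺ children (layer-∈ k dp≡))
    where
    v≢root : v ≢ root
    v≢root refl = 0≢1+n (trans (sym depth-root) d≡)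
    dp≡ : depth (parent v) ≡ k
    dp≡ = suc-injective (trans (sym (depth-parent v≢root)) d≡)

  layer-length : ∀ {D} → (∀ u → length (children u) ≤ D) → ∀ k → length (layer k) ≤ D ^ k
  layer-length bushy zero          = ≤-refl
  layer-length {D} bushy (suc k) = ≤-trans (length-concatMap-≤ children (layer k) bushy) (*-monoʳ-≤ D (layer-length bushy k))

  layers-below : ℕ → List V
  layers-below zero    = []
  layers-below (suc k) = layer k ++ layers-below k

  layers-below-∈ : ∀ {v} K → depth v < K → v ∈ layers-below K
  layers-below-∈ (suc K) d<K with m≤n⇒m<n∨m≡n (≤-pred d<K)
  ... | inj₁ d<K′ = ∈-++⁺ʳ (layer K) (layers-below-∈ K d<K′)
  ... | inj₂ d≡K  = ∈-++⁺ˡ (layer-∈ K d≡K)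

  layers-below-length : ∀ {D} → (∀ u → length (children u) ≤ D) → ∀ K → length (layers-below K) ≤ powerSum D K
  layers-below-length bushy zero    = z≤n
  layers-below-length bushy (suc K) =
    subst (_≤ _) (sym (length-++ (layer K))) (+-mono-≤ (layer-length bushy K) (layers-below-length bushy K))

  deep-or-bushy : ∀ K D → suc (powerSum D K) ≤ n G →
                  (Σ V λ v → K ≤ depth v) ⊎ ((∀ v → depth v < K) × Σ V λ u → suc D ≤ length (children u))
  deep-or-bushy K D big with all? (λ v → depth v <? K)
  ... | no not-shallow = let v , d≮K = ¬∀⟶∃¬ (n G) _ (λ v → depth v <? K) not-shallow in inj₁ (v , ≮⇒≥ d≮K)
  ... | yes shallow with all? (λ u → length (children u) ≤? D)
  ...   | no not-thin = let u , c≰D = ¬∀⟶∃¬ (n G) _ (λ u → length (children u) ≤? D) not-thin in inj₂ (shallow , u , ≰⇒> c≰D)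
  ...   | yes thin = ⊥-elim (<⇒≱ big (begin
    n G                          ≡⟨ sym (length-tabulate id) ⟩
    length (allFin (n G))        ≤⟨ Unique-⊆⇒length-≤ (allFin⁺ (n G)) (λ {v} _ → layers-below-∈ K (shallow v)) ⟩
    length (layers-below K)      ≤⟨ layers-below-length thin K ⟩
    powerSum D K                 ∎))
    where open ≤-Reasoning

  module LowEdges (tec : TwoEdgeConnected G) where

    lowEdge : V → V × V
    lowEdge v with v ≟ root
    ... | yes _     = root , root
    ... | no v≢root = proj₁ (lowEdge-exists tec v≢root) , proj₁ (proj₂ (lowEdge-exists tec v≢root))

    lowEdge-spec : ∀ {v} → v ≢ root → LowEdge v (proj₁ (lowEdge v)) (proj₂ (lowEdge v))
    lowEdge-spec {v} v≢root with v ≟ root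
    ... | yes v≡root = ⊥-elim (v≢root v≡root)
    ... | no v≢root′ = proj₂ (proj₂ (lowEdge-exists tec v≢root′))

module ManyChildren {G : Graph} {root : Vtx G} (tree : NormalSpanningTree G root) (tec : TwoEdgeConnected G) where
  open Walks G
  open NormalSpanningTree tree
  open NormalTrees tree
  open LowEdges tec
  open Flowers G
  open K2rSubdivisions G

  lowFrom lowTo : V → V
  lowFrom = proj₁ ∘ lowEdge
  lowTo   = proj₂ ∘ lowEdge

  -- The low edges of the children cs of u all end at the same ancestor a of u, since they end at
  -- the same depth. With the tree paths up to the children they form a flower at u if a = u,
  -- and a subdivided K₂,ᵣ between a and u otherwise.
  module Fan {r u d} (0<r : 0 < r) (cs : List V) (cs-unique : Unique cs) (cs-children : cs ⊆ children u)
             (same-depth : ∀ {c} → c ∈ cs → depth (lowTo c) ≡ d) (r≤ : r ≤ length cs) where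

    child x y : ℕ → V
    child = lookupOr u cs
    x     = lowFrom ∘ child
    y     = lowTo ∘ child

    child-∈ : ∀ {q} → q < r → child q ∈ cs
    child-∈ q<r = lookupOr-∈ u cs (<-≤-trans q<r r≤)

    child-injective : ∀ {q q′} → q < r → q′ < r → child q ≡ child q′ → q ≡ q′
    child-injective q<r q′<r = lookupOr-injective u cs-unique (<-≤-trans q<r r≤) (<-≤-trans q′<r r≤)

    child≢root : ∀ {q} → q < r → child q ≢ root
    child≢root q<r = proj₁ (∈-children⁻ (cs-children (child-∈ q<r)))

    parent-child : ∀ {q} → q < r → parent (child q) ≡ u
    parent-child q<r = proj₂ (∈-children⁻ (cs-children (child-∈ q<r)))

    depth-child : ∀ {q} → q < r → depth (child q) ≡ suc (depth u)
    depth-child q<r = trans (depth-parent (child≢root q<r)) (cong (suc ∘ depth) (parent-child q<r))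

    low : ∀ {q} → q < r → LowEdge (child q) (x q) (y q)
    low q<r = lowEdge-spec (child≢root q<r)

    child⊑x : ∀ {q} → q < r → child q ⊑ x q
    child⊑x q<r = proj₁ (low q<r)

    y⊑u : ∀ {q} → q < r → y q ⊑ u
    y⊑u {q} q<r = subst (y q ⊑_) (parent-child q<r) (proj₁ (proj₂ (proj₂ (low q<r))))

    depth-y : ∀ {q} → q < r → depth (y q) ≡ d
    depth-y q<r = same-depth (child-∈ q<r)

    subtrees-disjoint : ∀ {q q′ w} → q < r → q′ < r → q ≢ q′ → child q ⊑ w → child q′ ⊑ w → ⊥
    subtrees-disjoint q<r q′<r q≢q′ q⊑w q′⊑w with ⊑-comparable q⊑w q′⊑w
    ... | inj₁ q⊑q′ = q≢q′ (child-injective q<r q′<r (⊑-depth-≡⇒≡ q⊑q′ (trans (depth-child q<r) (sym (depth-child q′<r)))))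
    ... | inj₂ q′⊑q = q≢q′ (sym (child-injective q′<r q<r (⊑-depth-≡⇒≡ q′⊑q (trans (depth-child q′<r) (sym (depth-child q<r))))))

    not-below-child : ∀ {q w} → q < r → depth w ≤ depth u → ¬ child q ⊑ w
    not-below-child q<r dw≤du q⊑w = 1+n≰n (≤-trans (≤-reflexive (sym (depth-child q<r))) (≤-trans (⊑⇒depth-≤ q⊑w) dw≤du))

    d≤depth-u : d ≤ depth u
    d≤depth-u = subst (_≤ depth u) (depth-y 0<r) (⊑⇒depth-≤ (y⊑u 0<r))

    climb : ℕ → List V
    climb q = up (x q) (depth (x q) ∸ depth (child q))

    iterate-climb : ∀ {q} → q < r → iterate parent (x q) (depth (x q) ∸ depth (child q)) ≡ child q
    iterate-climb q<r = ⊑-canonical (child⊑x q<r)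

    climb-unique : ∀ {q} → q < r → Unique (x q ∷ climb q)
    climb-unique {q} q<r = up-unique (x q) _ (m∸n≤m (depth (x q)) (depth (child q)))

    climb-below : ∀ {q w} → q < r → w ∈ x q ∷ climb q → child q ⊑ w
    climb-below q<r w∈ = subst (_⊑ _) (iterate-climb q<r) (proj₂ (up-⊑ _ _ w∈))

    climb-arc : ∀ {q} → q < r → Arc (x q) u (climb q)
    climb-arc {q} q<r = subst (λ v → Arc (x q) v (climb q)) reaches-u (up-arc (x q) _ k<d)
      where
      k<d : suc (depth (x q) ∸ depth (child q)) ≤ depth (x q)
      k<d = ∸-monoʳ-< {o = 0} (subst (0 <_) (sym (depth-child q<r)) (s≤s z≤n)) (⊑⇒depth-≤ (child⊑x q<r))
      reaches-u : iterate parent (x q) (suc (depth (x q) ∸ depth (child q))) ≡ u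
      reaches-u = trans (iterate-suc parent (x q) (depth (x q) ∸ depth (child q))) (trans (cong parent (iterate-climb q<r)) (parent-child q<r))

    module _ (d≡depth-u : d ≡ depth u) where

      y≡u : ∀ {q} → q < r → y q ≡ u
      y≡u q<r = ⊑-depth-≡⇒≡ (y⊑u q<r) (trans (depth-y q<r) d≡depth-u)

      x≢child : ∀ {q} → q < r → x q ≢ child q
      x≢child q<r x≡c = proj₂ (proj₂ (proj₂ (low q<r))) (x≡c , trans (y≡u q<r) (sym (parent-child q<r)))

      middle : ℕ → List V
      middle q = up (x q) (pred (depth (x q) ∸ depth (child q)))

      climb≡ : ∀ {q} → q < r → climb q ≡ middle q ++ [ child q ]
      climb≡ {q} q<r = begin
        up (x q) k                                   ≡⟨ cong (up (x q)) k≡ ⟩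
        up (x q) (suc (pred k))                      ≡⟨ up-snoc (x q) (pred k) ⟩
        middle q ++ [ iterate parent (x q) (suc (pred k)) ] ≡⟨ cong (λ j → middle q ++ [ iterate parent (x q) j ]) (sym k≡) ⟩
        middle q ++ [ iterate parent (x q) k ]       ≡⟨ cong (λ v → middle q ++ [ v ]) (iterate-climb q<r) ⟩
        middle q ++ [ child q ]                      ∎
        where
        open ≡-Reasoning
        k : ℕ
        k = depth (x q) ∸ depth (child q)
        k≡ : k ≡ suc (pred k)
        k≡ = sym (suc-pred k {{>-nonZero (m<n⇒0<n∸m (⊑-depth-< (child⊑x q<r) (x≢child q<r ∘ sym)))}})

      petal⊆climb : ∀ {q w} → q < r → w ∈ x q ∷ middle q ++ [ child q ] → w ∈ x q ∷ climb q
      petal⊆climb q<r = subst (λ zs → _ ∈ x _ ∷ zs) (sym (climb≡ q<r))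

      flower : Flower r
      flower = record
        { centre = u ; first = x ; last = child ; middle = middle
        ; centre-first = λ {q} q<r → subst (λ v → Edge G v (x q)) (y≡u q<r) (edge-sym (proj₁ (proj₂ (low q<r))))
        ; last-centre = λ q<r → subst (Edge G _) (parent-child q<r) (edge-parent (child≢root q<r))
        ; arc = λ {q} q<r → proj₁ (arc-split (middle q) (child q) [] (subst (Arc (x q) u) (climb≡ q<r) (climb-arc q<r)))
        ; unique = λ q<r → subst (λ zs → Unique (x _ ∷ zs)) (climb≡ q<r) (climb-unique q<r)
        ; centre∉ = λ q<r u∈ → not-below-child q<r ≤-refl (climb-below q<r (petal⊆climb q<r u∈))
        ; disjoint = λ q<r q′<r q≢q′ (v∈ , v∈′) →
            subtrees-disjoint q<r q′<r q≢q′ (climb-below q<r (petal⊆climb q<r v∈)) (climb-below q′<r (petal⊆climb q′<r v∈′)) }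

    module _ (d<depth-u : d < depth u) where

      y≡y₀ : ∀ {q} → q < r → y q ≡ y 0
      y≡y₀ q<r = ⊑-unique-at-depth (y⊑u q<r) (y⊑u 0<r) (trans (depth-y q<r) (sym (depth-y 0<r)))

      subdividedK2r : SubdividedK2r r
      subdividedK2r = record
        { a = y 0 ; b = u ; first = x ; rest = climb
        ; a≢b = λ y₀≡u → <-irrefl (trans (sym (depth-y 0<r)) (cong depth y₀≡u)) d<depth-u
        ; arc = λ {q} q<r → subst (λ v → Edge G v (x q)) (y≡y₀ q<r) (edge-sym (proj₁ (proj₂ (low q<r)))) ▸ climb-arc q<r
        ; unique = climb-unique
        ; a∉ = λ q<r a∈ → not-below-child q<r (≤-trans (≤-reflexive (depth-y 0<r)) (<⇒≤ d<depth-u)) (climb-below q<r a∈)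
        ; b∉ = λ q<r b∈ → not-below-child q<r ≤-refl (climb-below q<r b∈)
        ; disjoint = λ q<r q′<r q≢q′ (v∈ , v∈′) →
            subtrees-disjoint q<r q′<r q≢q′ (climb-below q<r v∈) (climb-below q′<r v∈′) }

    flower-or-K2r : Flower r ⊎ SubdividedK2r r
    flower-or-K2r with m≤n⇒m<n∨m≡n d≤depth-u
    ... | inj₁ d<depth-u = inj₂ (subdividedK2r d<depth-u)
    ... | inj₂ d≡depth-u = inj₁ (flower d≡depth-u)

  flower-or-K2r : ∀ {r K u} → 0 < r → (∀ v → depth v < K) → suc (r * K) ≤ length (children u) → Flower r ⊎ SubdividedK2r r
  flower-or-K2r {r} {K} {u} 0<r shallow many =
    let d , cs , cs-unique , cs⊆ , same-depth , r≤ = pigeonhole (depth ∘ lowTo) r K (children-unique u) low-shallow many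
    in  Fan.flower-or-K2r 0<r cs cs-unique cs⊆ same-depth r≤
    where
    low-shallow : ∀ {c} → c ∈ children u → depth (lowTo c) < K
    low-shallow c∈ with c≢root , refl ← ∈-children⁻ c∈ =
      ≤-<-trans (⊑⇒depth-≤ (proj₁ (proj₂ (proj₂ (lowEdge-spec c≢root))))) (shallow _)

module Ladders (G : Graph) where
  open Walks G
  open LongCycles G using (LongCycle)
  open CycleChains G using (CycleChain)

  -- A path p 0, …, p L together with, for every 1 ≤ i ≤ L, an ear from p (foot i) to p (top i)
  -- jumping over p i, whose inner vertices hang off the path at p (top i).
  record EarSystem (L : ℕ) : Set₁ where
    field
      p              : ℕ → V
      path-edge      : ∀ {j} → j < L → Edge G (p j) (p (suc j))
      p-injective    : ∀ {j j′} → j ≤ L → j′ ≤ L → p j ≡ p j′ → j ≡ j′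
      Hangs          : ℕ → V → Set
      hangs-off-path : ∀ {h v j} → Hangs h v → j ≤ L → v ≢ p j
      hangs-unique   : ∀ {h h′ v} → Hangs h v → Hangs h′ v → h ≡ h′
      foot top       : ℕ → ℕ
      ear            : ℕ → List V
      ear-arc        : ∀ {i} → 1 ≤ i → i ≤ L → Arc (p (foot i)) (p (top i)) (ear i)
      ear-unique     : ∀ {i} → 1 ≤ i → i ≤ L → Unique (ear i)
      ear-hangs      : ∀ {i v} → 1 ≤ i → i ≤ L → v ∈ ear i → Hangs (top i) v
      ear-nontrivial : ∀ {i} → 1 ≤ i → i ≤ L → 2 ≤ length (ear i) + (top i ∸ foot i)
      foot<          : ∀ {i} → 1 ≤ i → i ≤ L → foot i < i
      ≤top           : ∀ {i} → 1 ≤ i → i ≤ L → i ≤ top i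
      top≤           : ∀ {i} → 1 ≤ i → i ≤ L → top i ≤ L

  module Ladder {L : ℕ} (E : EarSystem L) {r : ℕ} (0<r : 0 < r) where
    open EarSystem E

    segment : ℕ → ℕ → List V
    segment a zero    = []
    segment a (suc b) with a ≤? b
    ... | yes _ = segment a b ++ [ p (suc b) ]
    ... | no _  = []

    segment-∈ : ∀ a b {v} → v ∈ segment a b → Σ ℕ λ j → a < j × j ≤ b × v ≡ p j
    segment-∈ a (suc b) v∈ with a ≤? b
    ... | yes a≤b with ∈-++⁻ (segment a b) v∈
    ...   | inj₁ v∈′ = let j , a<j , j≤b , v≡ = segment-∈ a b v∈′ in j , a<j , m≤n⇒m≤1+n j≤b , v≡
    ...   | inj₂ (here v≡) = suc b , s≤s a≤b , ≤-refl , v≡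

    segment-∈< : ∀ {a b v} → a < b → v ∈ segment a (pred b) → Σ ℕ λ j → a < j × j < b × v ≡ p j
    segment-∈< {a} {suc b} _ v∈ = let j , a<j , j≤b , v≡ = segment-∈ a b v∈ in j , a<j , s≤s j≤b , v≡

    segment-length : ∀ a b → length (segment a b) ≡ b ∸ a
    segment-length a zero    = sym (0∸n≡0 a)
    segment-length a (suc b) with a ≤? b
    ... | yes a≤b = trans (length-++ (segment a b)) (trans (cong (_+ 1) (segment-length a b))
                      (trans (+-comm (b ∸ a) 1) (sym (+-∸-assoc 1 a≤b))))
    ... | no a≰b  = sym (m≤n⇒m∸n≡0 (≰⇒> a≰b))

    segment-unique : ∀ a b → b ≤ L → Unique (segment a b)
    segment-unique a zero    _   = []
    segment-unique a (suc b) b≤L with a ≤? b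
    ... | no _  = []
    ... | yes _ = ++⁺ (segment-unique a b (<⇒≤ b≤L)) Unique-[ _ ] λ { (v∈ , here refl) → fresh v∈ }
      where
      fresh : p (suc b) ∉ segment a b
      fresh pb∈ with j , _ , j≤b , pb≡ ← segment-∈ a b pb∈ =
        1+n≰n (≤-trans (≤-reflexive (p-injective b≤L (≤-trans j≤b (<⇒≤ b≤L)) pb≡)) j≤b)

    segment-walk : ∀ {a b} → a ≤ b → b ≤ L → Walk (p a) (p b) (p a ∷ segment a b)
    segment-walk {b = zero} z≤n _ = stop (p 0)
    segment-walk {a} {suc b} a≤sb sb≤L with a ≤? b
    ... | yes a≤b = walk-snoc (segment-walk a≤b (<⇒≤ sb≤L)) (path-edge sb≤L)
    ... | no a≰b with refl ← ≤-antisym a≤sb (≰⇒> a≰b) = stop (p (suc b))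

    segment-arc : ∀ {a b} → a < b → b ≤ L → Arc (p a) (p b) (segment a (pred b))
    segment-arc {a} {suc b} (s≤s a≤b) sb≤L = walk-snoc (segment-walk a≤b (<⇒≤ sb≤L)) (path-edge sb≤L)

    Located : ℕ → ℕ → ℕ → V → Set
    Located c mid far v = (Σ ℕ λ j → c < j × j ≤ mid × v ≡ p j) ⊎ (Σ ℕ λ h → c < h × h ≤ far × Hangs h v)

    InRegion : ℕ → ℕ → V → Set
    InRegion lo hi v = (Σ ℕ λ j → lo < j × j < hi × v ≡ p j) ⊎ (Σ ℕ λ h → lo < h × h ≤ hi × Hangs h v)

    located-on-path : ∀ {c mid far v j} → mid ≤ L → j ≤ L → Located c mid far v → v ≡ p j → c < j × j ≤ mid
    located-on-path mid≤L j≤L (inj₁ (j′ , c<j′ , j′≤mid , refl)) v≡ with refl ← p-injective (≤-trans j′≤mid mid≤L) j≤L v≡ =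
      c<j′ , j′≤mid
    located-on-path mid≤L j≤L (inj₂ (_ , _ , _ , hangs)) v≡ = ⊥-elim (hangs-off-path hangs j≤L v≡)

    located-hanging : ∀ {c mid far v h} → mid ≤ L → Located c mid far v → Hangs h v → c < h × h ≤ far
    located-hanging mid≤L (inj₁ (j , _ , j≤mid , refl)) hangs = ⊥-elim (hangs-off-path hangs (≤-trans j≤mid mid≤L) refl)
    located-hanging mid≤L (inj₂ (h , c<h , h≤far , hangs′)) hangs with refl ← hangs-unique hangs hangs′ = c<h , h≤far

    located-weaken : ∀ {c mid far mid′ far′ v} → mid ≤ mid′ → far ≤ far′ → Located c mid far v → Located c mid′ far′ v
    located-weaken mid≤ _ (inj₁ (j , c<j , j≤mid , v≡)) = inj₁ (j , c<j , ≤-trans j≤mid mid≤ , v≡)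
    located-weaken _ far≤ (inj₂ (h , c<h , h≤far , hangs)) = inj₂ (h , c<h , ≤-trans h≤far far≤ , hangs)

    -- After k ears, the block opened at c is the cycle made of the walk A from p c to p mid,
    -- the path from p mid to p far, and the arc B from p c to p far.
    record OpenBlock (c k : ℕ) : Set where
      field
        mid far    : ℕ
        A B        : List V
        walk-A     : Walk (p c) (p mid) (p c ∷ A)
        arc-B      : Arc (p c) (p far) B
        c≤mid      : c ≤ mid
        mid<far    : mid < far
        far≤L      : far ≤ L
        unique-A   : Unique A
        unique-B   : Unique B
        A#B        : Disjoint A B
        located-A  : ∀ {v} → v ∈ A → Located c mid far v
        located-B  : ∀ {v} → v ∈ B → Located c mid far v
        covers     : ∀ {i} → 1 ≤ i → i ≤ L → foot i < mid → top i ≤ far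
        nontrivial : 2 ≤ length A + length B + (far ∸ mid)
        grows      : k ≤ length A + length B + 1
        bounded    : far ≤ c + k * r

    module BlockCycle {c k : ℕ} (S : OpenBlock c k) where
      open OpenBlock S

      mid≤L : mid ≤ L
      mid≤L = ≤-trans (<⇒≤ mid<far) far≤L

      c≤L : c ≤ L
      c≤L = ≤-trans c≤mid mid≤L

      tail : List V
      tail = segment mid (pred far)

      tail-∈ : ∀ {v} → v ∈ tail → Σ ℕ λ j → mid < j × j < far × v ≡ p j
      tail-∈ = segment-∈< mid<far

      Q : List V
      Q = A ++ tail

      arc-Q : Arc (p c) (p far) Q
      arc-Q = subst (λ zs → Walk (p c) (p far) (p c ∷ zs)) (sym (++-assoc A tail [ p far ])) (walk-A ++ʷ segment-arc mid<far far≤L)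

      A#tail : Disjoint A tail
      A#tail (v∈A , v∈tail) with j , mid<j , j<far , refl ← tail-∈ v∈tail =
        <⇒≱ mid<j (proj₂ (located-on-path mid≤L (≤-trans (<⇒≤ j<far) far≤L) (located-A v∈A) refl))

      B#Q : Disjoint B Q
      B#Q (v∈B , v∈Q) with ∈-++⁻ A v∈Q
      ... | inj₁ v∈A    = A#B (v∈A , v∈B)
      ... | inj₂ v∈tail with j , mid<j , j<far , refl ← tail-∈ v∈tail =
        <⇒≱ mid<j (proj₂ (located-on-path mid≤L (≤-trans (<⇒≤ j<far) far≤L) (located-B v∈B) refl))

      c≢far : p c ≢ p far
      c≢far eq = <⇒≢ (≤-<-trans c≤mid mid<far) (p-injective c≤L far≤L eq)

      located-≢c : ∀ {v} → Located c mid far v → v ≢ p c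
      located-≢c loc v≡ = <-irrefl refl (proj₁ (located-on-path mid≤L c≤L loc v≡))

      located-≢far : ∀ {v} → Located c mid far v → v ≢ p far
      located-≢far loc v≡ = <⇒≱ mid<far (proj₂ (located-on-path mid≤L far≤L loc v≡))

      c∉Q : p c ∉ Q
      c∉Q c∈ with ∈-++⁻ A c∈
      ... | inj₁ c∈A    = located-≢c (located-A c∈A) refl
      ... | inj₂ c∈tail with j , mid<j , j<far , c≡ ← tail-∈ c∈tail
        with refl ← p-injective c≤L (≤-trans (<⇒≤ j<far) far≤L) c≡ = <⇒≱ mid<j c≤mid

      far∉Q : p far ∉ Q
      far∉Q far∈ with ∈-++⁻ A far∈
      ... | inj₁ far∈A    = located-≢far (located-A far∈A) refl
      ... | inj₂ far∈tail with j , _ , j<far , far≡ ← tail-∈ far∈tail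
        with refl ← p-injective far≤L (≤-trans (<⇒≤ j<far) far≤L) far≡ = <-irrefl refl j<far

      s : ℕ
      s = pred far ∸ mid

      far∸mid≡ : far ∸ mid ≡ suc s
      far∸mid≡ with suc f ← far | s≤s mid≤f ← mid<far = +-∸-assoc 1 mid≤f

      sizes : length B + length Q ≡ length A + length B + s
      sizes = begin
        length B + length (A ++ tail)        ≡⟨ cong (length B +_) (length-++ A) ⟩
        length B + (length A + length tail)  ≡⟨ cong (λ n → length B + (length A + n)) (segment-length mid (pred far)) ⟩
        length B + (length A + s)            ≡⟨ sym (+-assoc (length B) (length A) s) ⟩
        length B + length A + s              ≡⟨ cong (_+ s) (+-comm (length B) (length A)) ⟩
        length A + length B + s              ∎
        where open ≡-Reasoning

      unique-Q : Unique Q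
      unique-Q = ++⁺ unique-A (segment-unique mid (pred far) (≤-trans pred[n]≤n far≤L)) A#tail

      B++Q-nonempty : 1 ≤ length B + length Q
      B++Q-nonempty = subst (1 ≤_) (sym sizes)
        (≤-pred (subst (2 ≤_) (trans (cong (length A + length B +_) far∸mid≡) (+-suc _ s)) nontrivial))

      pair : Σ (ArcPair (p c) (p far)) λ A → length (cycle A) ≡ 2 + (length B + length Q) ×
                                             (∀ {v} → v ∈ ArcPair.X A ++ ArcPair.Y A → v ∈ B ⊎ v ∈ Q)
      pair = arcPair B Q arc-B arc-Q unique-B unique-Q B#Q c≢far (λ c∈ → located-≢c (located-B c∈) refl) c∉Q
                     (λ far∈ → located-≢far (located-B far∈) refl) far∉Q B++Q-nonempty

      arcs : ArcPair (p c) (p far)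
      arcs = proj₁ pair

      arcs-long : suc k ≤ length (cycle arcs)
      arcs-long = begin
        suc k                          ≤⟨ s≤s (≤-trans grows (≤-reflexive (+-comm _ 1))) ⟩
        2 + (length A + length B)      ≤⟨ +-monoʳ-≤ 2 (m≤m+n _ s) ⟩
        2 + (length A + length B + s)  ≡⟨ cong (2 +_) (sym sizes) ⟩
        2 + (length B + length Q)      ≡⟨ sym (proj₁ (proj₂ pair)) ⟩
        length (cycle arcs)            ∎
        where open ≤-Reasoning

      located⇒InRegion : ∀ {v} → Located c mid far v → InRegion c far v
      located⇒InRegion (inj₁ (j , c<j , j≤mid , v≡)) = inj₁ (j , c<j , ≤-<-trans j≤mid mid<far , v≡)
      located⇒InRegion (inj₂ hanging)                = inj₂ hanging

      arcs-inRegion : ∀ {v} → v ∈ ArcPair.X arcs ++ ArcPair.Y arcs → InRegion c far v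
      arcs-inRegion v∈ with proj₂ (proj₂ pair) v∈
      ... | inj₁ v∈B = located⇒InRegion (located-B v∈B)
      ... | inj₂ v∈Q with ∈-++⁻ A v∈Q
      ...   | inj₁ v∈A    = located⇒InRegion (located-A v∈A)
      ...   | inj₂ v∈tail = let j , mid<j , j<far , v≡ = tail-∈ v∈tail in inj₁ (j , ≤-<-trans c≤mid mid<j , j<far , v≡)

    long-ear : ∀ {i} → 1 ≤ i → i ≤ L → foot i + r ≤ top i → LongCycle r
    long-ear {i} 1≤i i≤L long = record { arcs = proj₁ pair ; long = subst (r ≤_) (sym (proj₁ (proj₂ pair))) r≤ }
      where
      foot<top : foot i < top i
      foot<top = <-≤-trans (foot< 1≤i i≤L) (≤top 1≤i i≤L)
      top≤L : top i ≤ L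
      top≤L = top≤ 1≤i i≤L
      foot≤L : foot i ≤ L
      foot≤L = ≤-trans (<⇒≤ foot<top) top≤L
      seg : List V
      seg = segment (foot i) (pred (top i))
      seg-∈ : ∀ {v} → v ∈ seg → Σ ℕ λ j → foot i < j × j < top i × v ≡ p j
      seg-∈ = segment-∈< foot<top
      ear#seg : Disjoint (ear i) seg
      ear#seg (v∈ear , v∈seg) with j , _ , j<top , v≡ ← seg-∈ v∈seg =
        hangs-off-path (ear-hangs 1≤i i≤L v∈ear) (≤-trans (<⇒≤ j<top) top≤L) v≡
      foot∉seg : p (foot i) ∉ seg
      foot∉seg foot∈ with j , foot<j , j<top , foot≡ ← seg-∈ foot∈
        with refl ← p-injective foot≤L (≤-trans (<⇒≤ j<top) top≤L) foot≡ = <-irrefl refl foot<j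
      top∉seg : p (top i) ∉ seg
      top∉seg top∈ with j , _ , j<top , top≡ ← seg-∈ top∈
        with refl ← p-injective top≤L (≤-trans (<⇒≤ j<top) top≤L) top≡ = <-irrefl refl j<top
      top∸foot≡ : top i ∸ foot i ≡ suc (length seg)
      top∸foot≡ with suc t ← top i | s≤s foot≤t ← foot<top =
        trans (+-∸-assoc 1 foot≤t) (cong suc (sym (segment-length (foot i) t)))
      pair : Σ (ArcPair (p (foot i)) (p (top i))) λ A → length (cycle A) ≡ 2 + (length (ear i) + length seg) ×
                                                         (∀ {v} → v ∈ ArcPair.X A ++ ArcPair.Y A → v ∈ ear i ⊎ v ∈ seg)
      pair = arcPair (ear i) seg (ear-arc 1≤i i≤L) (segment-arc foot<top top≤L) (ear-unique 1≤i i≤L)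
                     (segment-unique (foot i) (pred (top i)) (≤-trans pred[n]≤n top≤L)) ear#seg
                     (λ eq → <⇒≢ foot<top (p-injective foot≤L top≤L eq))
                     (λ foot∈ → hangs-off-path (ear-hangs 1≤i i≤L foot∈) foot≤L refl) foot∉seg
                     (λ top∈ → hangs-off-path (ear-hangs 1≤i i≤L top∈) top≤L refl) top∉seg
                     (≤-pred (subst (2 ≤_) (trans (cong (length (ear i) +_) top∸foot≡) (+-suc _ _)) (ear-nontrivial 1≤i i≤L)))
      r≤ : r ≤ 2 + (length (ear i) + length seg)
      r≤ = begin
        r                                ≡⟨ sym (m+n∸m≡n (foot i) r) ⟩
        foot i + r ∸ foot i              ≤⟨ ∸-monoˡ-≤ (foot i) long ⟩
        top i ∸ foot i                   ≡⟨ top∸foot≡ ⟩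
        suc (length seg)                 ≤⟨ s≤s (m≤n+m (length seg) (length (ear i))) ⟩
        suc (length (ear i) + length seg) ≤⟨ n≤1+n _ ⟩
        2 + (length (ear i) + length seg) ∎
        where open ≤-Reasoning

    module Extend {c k} (S : OpenBlock c k) {i} (1≤i : 1 ≤ i) (i≤L : i ≤ L)
                  (foot<far : foot i < OpenBlock.far S) (far<top : OpenBlock.far S < top i)
                  (maximal : ∀ {i′} → 1 ≤ i′ → i′ ≤ L → foot i′ < OpenBlock.far S → top i′ ≤ top i)
                  (short : top i < foot i + r) where
      open OpenBlock S
      open BlockCycle S using (mid≤L; c≤L; located-≢far)

      mid≤foot : mid ≤ foot i
      mid≤foot = ≮⇒≥ λ foot<mid → <⇒≱ far<top (covers 1≤i i≤L foot<mid)

      foot≤L : foot i ≤ L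
      foot≤L = ≤-trans (<⇒≤ foot<far) far≤L

      seg : List V
      seg = segment mid (foot i)

      seg-∈ : ∀ {v} → v ∈ seg → Σ ℕ λ j → mid < j × j ≤ foot i × v ≡ p j
      seg-∈ = segment-∈ mid (foot i)

      A′ B′ : List V
      A′ = B ++ [ p far ]
      B′ = A ++ seg ++ ear i

      arc-B′ : Arc (p c) (p (top i)) B′
      arc-B′ = subst (λ zs → Walk (p c) (p (top i)) (p c ∷ zs)) reassoc
                     ((walk-A ++ʷ segment-walk mid≤foot foot≤L) ++ʷ ear-arc 1≤i i≤L)
        where
        reassoc : (A ++ seg) ++ ear i ++ [ p (top i) ] ≡ (A ++ seg ++ ear i) ++ [ p (top i) ]
        reassoc = trans (++-assoc A seg _) (trans (cong (A ++_) (sym (++-assoc seg (ear i) _))) (sym (++-assoc A (seg ++ ear i) _)))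

      located-outside : ∀ {v} → Located c mid far v → v ∉ seg ++ ear i
      located-outside loc v∈ with ∈-++⁻ seg v∈
      ... | inj₁ v∈seg with j , mid<j , j≤foot , refl ← seg-∈ v∈seg =
        <⇒≱ mid<j (proj₂ (located-on-path mid≤L (≤-trans j≤foot foot≤L) loc refl))
      ... | inj₂ v∈ear = <⇒≱ far<top (proj₂ (located-hanging mid≤L loc (ear-hangs 1≤i i≤L v∈ear)))

      far∉seg++ear : p far ∉ seg ++ ear i
      far∉seg++ear far∈ with ∈-++⁻ seg far∈
      ... | inj₁ far∈seg with j , _ , j≤foot , far≡ ← seg-∈ far∈seg
        with refl ← p-injective far≤L (≤-trans j≤foot foot≤L) far≡ = <⇒≱ foot<far j≤foot
      ... | inj₂ far∈ear = hangs-off-path (ear-hangs 1≤i i≤L far∈ear) far≤L refl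

      unique-A′ : Unique A′
      unique-A′ = ++⁺ unique-B Unique-[ p far ] λ { (far∈B , here refl) → located-≢far (located-B far∈B) refl }

      unique-B′ : Unique B′
      unique-B′ = ++⁺ unique-A (++⁺ (segment-unique mid (foot i) foot≤L) (ear-unique 1≤i i≤L) seg#ear)
                      (λ (v∈A , v∈) → located-outside (located-A v∈A) v∈)
        where
        seg#ear : Disjoint seg (ear i)
        seg#ear (v∈seg , v∈ear) with j , _ , j≤foot , v≡ ← seg-∈ v∈seg =
          hangs-off-path (ear-hangs 1≤i i≤L v∈ear) (≤-trans j≤foot foot≤L) v≡

      A′#B′ : Disjoint A′ B′
      A′#B′ (v∈A′ , v∈B′) with ∈-++⁻ B v∈A′ | ∈-++⁻ A v∈B′
      ... | inj₁ v∈B          | inj₁ v∈A = A#B (v∈A , v∈B)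
      ... | inj₁ v∈B          | inj₂ v∈  = located-outside (located-B v∈B) v∈
      ... | inj₂ (here refl)  | inj₁ v∈A = located-≢far (located-A v∈A) refl
      ... | inj₂ (here refl)  | inj₂ v∈  = far∉seg++ear v∈

      located-A′ : ∀ {v} → v ∈ A′ → Located c far (top i) v
      located-A′ v∈ with ∈-++⁻ B v∈
      ... | inj₁ v∈B         = located-weaken (<⇒≤ mid<far) (<⇒≤ far<top) (located-B v∈B)
      ... | inj₂ (here refl) = inj₁ (far , ≤-<-trans c≤mid mid<far , ≤-refl , refl)

      located-B′ : ∀ {v} → v ∈ B′ → Located c far (top i) v
      located-B′ v∈ with ∈-++⁻ A v∈
      ... | inj₁ v∈A = located-weaken (<⇒≤ mid<far) (<⇒≤ far<top) (located-A v∈A)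
      ... | inj₂ v∈′ with ∈-++⁻ seg v∈′
      ...   | inj₁ v∈seg = let j , mid<j , j≤foot , v≡ = seg-∈ v∈seg in
                           inj₁ (j , ≤-<-trans c≤mid mid<j , ≤-trans j≤foot (<⇒≤ foot<far) , v≡)
      ...   | inj₂ v∈ear = inj₂ (top i , ≤-<-trans c≤mid (<-trans mid<far far<top) , ≤-refl , ear-hangs 1≤i i≤L v∈ear)

      length-A′ : length A′ ≡ suc (length B)
      length-A′ = trans (length-++ B) (+-comm (length B) 1)

      length-A≤B′ : length A ≤ length B′
      length-A≤B′ = subst (length A ≤_) (sym (length-++ A)) (m≤m+n (length A) _)

      nontrivial′ : 2 ≤ length A′ + length B′ + (top i ∸ far)
      nontrivial′ = +-mono-≤ (≤-trans (subst (1 ≤_) (sym length-A′) (s≤s z≤n)) (m≤m+n _ _)) (m<n⇒0<n∸m far<top)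

      grows′ : suc k ≤ length A′ + length B′ + 1
      grows′ = begin
        suc k                                  ≤⟨ s≤s grows ⟩
        suc (length A + length B + 1)          ≤⟨ s≤s (+-monoˡ-≤ 1 (+-monoˡ-≤ (length B) length-A≤B′)) ⟩
        suc (length B′ + length B + 1)         ≡⟨ cong (λ n → suc (n + 1)) (+-comm (length B′) (length B)) ⟩
        suc (length B + length B′ + 1)         ≡⟨ cong (λ n → n + length B′ + 1) (sym length-A′) ⟩
        length A′ + length B′ + 1              ∎
        where open ≤-Reasoning

      bounded′ : top i ≤ c + suc k * r
      bounded′ = begin
        top i            ≤⟨ <⇒≤ short ⟩
        foot i + r       ≤⟨ +-monoˡ-≤ r (<⇒≤ foot<far) ⟩
        far + r          ≤⟨ +-monoˡ-≤ r bounded ⟩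
        c + k * r + r    ≡⟨ +-assoc c (k * r) r ⟩
        c + (k * r + r)  ≡⟨ cong (c +_) (+-comm (k * r) r) ⟩
        c + suc k * r    ∎
        where open ≤-Reasoning

      extended : OpenBlock c (suc k)
      extended = record
        { mid = far ; far = top i ; A = A′ ; B = B′ ; walk-A = arc-B ; arc-B = arc-B′
        ; c≤mid = ≤-trans c≤mid (<⇒≤ mid<far) ; mid<far = far<top ; far≤L = top≤ 1≤i i≤L
        ; unique-A = unique-A′ ; unique-B = unique-B′ ; A#B = A′#B′ ; located-A = located-A′ ; located-B = located-B′
        ; covers = maximal ; nontrivial = nontrivial′ ; grows = grows′ ; bounded = bounded′ }

    Cut : ℕ → Set
    Cut c = ∀ {i} → 1 ≤ i → i ≤ L → foot i < c → top i ≤ c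

    open-block : ∀ {c} → c < L → Cut c → top (suc c) < foot (suc c) + r → OpenBlock c 1
    open-block {c} c<L cut short = record
      { mid = c ; far = top (suc c) ; A = [] ; B = ear (suc c)
      ; walk-A = stop (p c) ; arc-B = subst (λ j → Arc (p j) (p (top (suc c))) (ear (suc c))) foot≡c (ear-arc 1≤ c<L)
      ; c≤mid = ≤-refl ; mid<far = ≤top 1≤ c<L ; far≤L = top≤ 1≤ c<L
      ; unique-A = [] ; unique-B = ear-unique 1≤ c<L ; A#B = λ ()
      ; located-A = λ () ; located-B = λ v∈ → inj₂ (top (suc c) , ≤top 1≤ c<L , ≤-refl , ear-hangs 1≤ c<L v∈)
      ; covers = λ 1≤i i≤L foot<c → ≤-trans (cut 1≤i i≤L foot<c) (<⇒≤ (≤top 1≤ c<L))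
      ; nontrivial = subst (λ j → 2 ≤ length (ear (suc c)) + (top (suc c) ∸ j)) foot≡c (ear-nontrivial 1≤ c<L)
      ; grows = m≤n+m 1 (length (ear (suc c)))
      ; bounded = ≤-trans (<⇒≤ short) (≤-reflexive (cong₂ _+_ foot≡c (sym (+-identityʳ r)))) }
      where
      1≤ : 1 ≤ suc c
      1≤ = s≤s z≤n
      foot≡c : foot (suc c) ≡ c
      foot≡c = ≤-antisym (≤-pred (foot< 1≤ c<L))
                         (≮⇒≥ λ foot<c → <⇒≱ (≤top 1≤ c<L) (cut 1≤ c<L foot<c))

    record Block (c : ℕ) : Set where
      field
        end      : ℕ
        c<end    : c < end
        cut      : Cut end
        arcs     : ArcPair (p c) (p end)
        inRegion : ∀ {v} → v ∈ ArcPair.X arcs ++ ArcPair.Y arcs → InRegion c end v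
        short    : end ≤ c + r * r

    -- Each round adds the ear reaching furthest beyond the block; after r rounds the cycle is long.
    close-block : ∀ fuel {c k} → OpenBlock c k → k + fuel ≡ r → LongCycle r ⊎ Block c
    close-block zero {k = k} S k≡r =
      inj₁ (record { arcs = arcs ; long = ≤-trans (≤-reflexive (trans (sym k≡r) (+-identityʳ k))) (≤-trans (n≤1+n k) arcs-long) })
      where open BlockCycle S
    close-block (suc fuel) {c} {k} S k+f≡r
      with bounded-argmax (λ i → (1 ≤? i) ×-dec (foot i <? far)) top L
      where open OpenBlock S
    ... | inj₁ none = ⊥-elim (none 1 1≤L (≤-refl , ≤-trans (foot< ≤-refl 1≤L) (≤-trans (s≤s z≤n) mid<far)))
      where
      open OpenBlock S
      1≤L : 1 ≤ L
      1≤L = ≤-trans (≤-trans (s≤s z≤n) mid<far) far≤L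
    ... | inj₂ (i , i≤L , (1≤i , foot<far) , maximal) with top i ≤? OpenBlock.far S
    ...   | yes top≤far = inj₂ (record
      { end = far ; c<end = ≤-<-trans c≤mid mid<far
      ; cut = λ 1≤j j≤L foot<far′ → ≤-trans (maximal _ j≤L (1≤j , foot<far′)) top≤far
      ; arcs = arcs ; inRegion = arcs-inRegion
      ; short = ≤-trans bounded (+-monoʳ-≤ c (*-monoˡ-≤ r (subst (k ≤_) k+f≡r (m≤m+n k (suc fuel))))) })
      where
      open OpenBlock S
      open BlockCycle S
    ...   | no top≰far with top i <? foot i + r
    ...     | yes short = close-block fuel (Extend.extended S 1≤i i≤L foot<far (≰⇒> top≰far)
                                            (λ 1≤j j≤L foot<far′ → maximal _ j≤L (1≤j , foot<far′)) short)
                                          (trans (sym (+-suc k fuel)) k+f≡r)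
    ...     | no long   = inj₁ (long-ear 1≤i i≤L (≮⇒≥ long))

    record BlockChain (R c : ℕ) : Set where
      field
        joint    : ℕ → ℕ
        apex     : ℕ → V
        X Y      : ℕ → List V
        joint-0  : joint 0 ≡ c
        joint-<  : ∀ {k} → k < R → joint k < joint (suc k)
        joint≤L  : joint R ≤ L
        arcX     : ∀ {k} → k < R → Arc (p (joint k)) (p (joint (suc k))) (apex k ∷ X k)
        arcY     : ∀ {k} → k < R → Arc (p (joint k)) (p (joint (suc k))) (Y k)
        unique   : ∀ {k} → k < R → Unique ((apex k ∷ X k) ++ Y k)
        inRegion : ∀ {k v} → k < R → v ∈ (apex k ∷ X k) ++ Y k → InRegion (joint k) (joint (suc k)) v

    block-∷ : ∀ {R c} (B : Block c) → BlockChain R (Block.end B) → BlockChain (suc R) c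
    block-∷ {R} {c} B P = record
      { joint = c ∷ˢ joint ; apex = h ∷ˢ apex ; X = rest ∷ˢ X ; Y = ArcPair.Y arcs ∷ˢ Y
      ; joint-0 = refl ; joint-< = joint-<′ ; joint≤L = joint≤L
      ; arcX = arcX′ ; arcY = arcY′ ; unique = unique′ ; inRegion = inRegion′ }
      where
      open BlockChain P
      open Block B using (arcs; c<end)
      h : V
      h = proj₁ (X-uncons arcs)
      rest : List V
      rest = proj₁ (proj₂ (X-uncons arcs))
      X≡ : ArcPair.X arcs ≡ h ∷ rest
      X≡ = proj₂ (proj₂ (X-uncons arcs))
      end≡ : Block.end B ≡ joint 0
      end≡ = sym joint-0
      joint-<′ : ∀ {k} → k < suc R → (c ∷ˢ joint) k < (c ∷ˢ joint) (suc k)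
      joint-<′ {zero}  _         = subst (c <_) end≡ c<end
      joint-<′ {suc k} (s≤s k<R) = joint-< k<R
      arcX′ : ∀ {k} → k < suc R → Arc (p ((c ∷ˢ joint) k)) (p (joint k)) ((h ∷ˢ apex) k ∷ (rest ∷ˢ X) k)
      arcX′ {zero}  _         = subst₂ (λ j xs → Arc (p c) (p j) xs) end≡ X≡ (ArcPair.arcX arcs)
      arcX′ {suc k} (s≤s k<R) = arcX k<R
      arcY′ : ∀ {k} → k < suc R → Arc (p ((c ∷ˢ joint) k)) (p (joint k)) ((ArcPair.Y arcs ∷ˢ Y) k)
      arcY′ {zero}  _         = subst (λ j → Arc (p c) (p j) (ArcPair.Y arcs)) end≡ (ArcPair.arcY arcs)
      arcY′ {suc k} (s≤s k<R) = arcY k<R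
      unique′ : ∀ {k} → k < suc R → Unique (((h ∷ˢ apex) k ∷ (rest ∷ˢ X) k) ++ (ArcPair.Y arcs ∷ˢ Y) k)
      unique′ {zero}  _         = subst (λ xs → Unique (xs ++ ArcPair.Y arcs)) X≡
                                        (++⁺ (ArcPair.unique-X arcs) (ArcPair.unique-Y arcs) (ArcPair.disjoint arcs))
      unique′ {suc k} (s≤s k<R) = unique k<R
      inRegion′ : ∀ {k v} → k < suc R → v ∈ ((h ∷ˢ apex) k ∷ (rest ∷ˢ X) k) ++ (ArcPair.Y arcs ∷ˢ Y) k →
                  InRegion ((c ∷ˢ joint) k) (joint k) v
      inRegion′ {zero}  {v} _   v∈ = subst (λ j → InRegion c j v) end≡
                                           (Block.inRegion B (subst (λ xs → v ∈ xs ++ ArcPair.Y arcs) (sym X≡) v∈))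
      inRegion′ {suc k} (s≤s k<R) = inRegion k<R

    fits⇒< : ∀ {c R} → c + suc R * (r * r) ≤ L → c < L
    fits⇒< {c} {R} fits =
      ≤-trans (subst (_≤ c + suc R * (r * r)) (+-comm c 1) (+-monoʳ-≤ c (≤-trans (*-mono-≤ 0<r 0<r) (m≤m+n (r * r) _)))) fits

    block-fits : ∀ {c R} (B : Block c) → c + suc R * (r * r) ≤ L → Block.end B + R * (r * r) ≤ L
    block-fits {c} {R} B fits = ≤-trans (+-monoˡ-≤ (R * (r * r)) (Block.short B)) (≤-trans (≤-reflexive (+-assoc c (r * r) _)) fits)

    block-chain : ∀ R c → c + R * (r * r) ≤ L → Cut c → LongCycle r ⊎ BlockChain R c
    block-chain zero c c≤L _ = inj₂ (record
      { joint = λ _ → c ; apex = λ _ → p c ; X = λ _ → [] ; Y = λ _ → []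
      ; joint-0 = refl ; joint-< = λ () ; joint≤L = subst (_≤ L) (+-identityʳ c) c≤L
      ; arcX = λ () ; arcY = λ () ; unique = λ () ; inRegion = λ () })
    block-chain (suc R) c fits cut with top (suc c) <? foot (suc c) + r
    ... | no long = inj₁ (long-ear (s≤s z≤n) (fits⇒< {R = R} fits) (≮⇒≥ long))
    ... | yes short with close-block (pred r) (open-block (fits⇒< {R = R} fits) cut short) (suc-pred r {{>-nonZero 0<r}})
    ...   | inj₁ long = inj₁ long
    ...   | inj₂ B with block-chain R (Block.end B) (block-fits {R = R} B fits) (Block.cut B)
    ...     | inj₁ long = inj₁ long
    ...     | inj₂ P    = inj₂ (block-∷ B P)

    module FromBlocks (P : BlockChain r 0) where
      open BlockChain P

      joint-mono-< : ∀ {a b} → a < b → b ≤ r → joint a < joint b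
      joint-mono-< {a} {suc b} (s≤s a≤b) sb≤r with m≤n⇒m<n∨m≡n a≤b
      ... | inj₂ refl = joint-< sb≤r
      ... | inj₁ a<b  = <-trans (joint-mono-< a<b (<⇒≤ sb≤r)) (joint-< sb≤r)

      joint-mono-≤ : ∀ {a b} → a ≤ b → b ≤ r → joint a ≤ joint b
      joint-mono-≤ a≤b b≤r with m≤n⇒m<n∨m≡n a≤b
      ... | inj₂ refl = ≤-refl
      ... | inj₁ a<b  = <⇒≤ (joint-mono-< a<b b≤r)

      joint-cancel-< : ∀ {a b} → a ≤ r → joint a < joint b → a < b
      joint-cancel-< {a} {b} a≤r ja<jb = ≰⇒> λ b≤a → <⇒≱ ja<jb (joint-mono-≤ b≤a a≤r)

      joint≤L′ : ∀ {k} → k ≤ r → joint k ≤ L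
      joint≤L′ k≤r = ≤-trans (joint-mono-≤ k≤r ≤-refl) joint≤L

      joint∉ : ∀ {k k′} → k ≤ r → k′ < r → p (joint k) ∉ (apex k′ ∷ X k′) ++ Y k′
      joint∉ {k} {k′} k≤r k′<r jk∈ with inRegion k′<r jk∈
      ... | inj₂ (_ , _ , _ , hangs) = hangs-off-path hangs (joint≤L′ k≤r) refl
      ... | inj₁ (j , jk′<j , j<jsk′ , jk≡) with refl ← p-injective (joint≤L′ k≤r) (≤-trans (<⇒≤ j<jsk′) (joint≤L′ k′<r)) jk≡ =
        <⇒≱ (joint-cancel-< (<⇒≤ k′<r) jk′<j) (≤-pred (joint-cancel-< k≤r j<jsk′))

      joint-injective : ∀ {k k′} → k ≤ r → k′ ≤ r → p (joint k) ≡ p (joint k′) → k ≡ k′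
      joint-injective {k} {k′} k≤r k′≤r eq with <-cmp k k′
      ... | tri≈ _ k≡k′ _ = k≡k′
      ... | tri< k<k′ _ _ = ⊥-elim (<⇒≢ (joint-mono-< k<k′ k′≤r) (p-injective (joint≤L′ k≤r) (joint≤L′ k′≤r) eq))
      ... | tri> _ _ k′<k = ⊥-elim (<⇒≢ (joint-mono-< k′<k k≤r) (sym (p-injective (joint≤L′ k≤r) (joint≤L′ k′≤r) eq)))

      regions-disjoint : ∀ {k k′ v} → k < k′ → k′ < r →
                         InRegion (joint k) (joint (suc k)) v → InRegion (joint k′) (joint (suc k′)) v → ⊥
      regions-disjoint {k} {k′} k<k′ k′<r (inj₁ (j , _ , j<jsk , refl)) (inj₁ (j′ , jk′<j′ , j′<jsk′ , pj≡))
        with refl ← p-injective (≤-trans (<⇒≤ j<jsk) (joint≤L′ (≤-trans k<k′ (<⇒≤ k′<r))))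
                                (≤-trans (<⇒≤ j′<jsk′) (joint≤L′ k′<r)) pj≡ =
        <-asym j<jsk (≤-<-trans (joint-mono-≤ k<k′ (<⇒≤ k′<r)) jk′<j′)
      regions-disjoint k<k′ k′<r (inj₁ (j , _ , j<jsk , v≡)) (inj₂ (_ , _ , _ , hangs)) =
        hangs-off-path hangs (≤-trans (<⇒≤ j<jsk) (joint≤L′ (≤-trans k<k′ (<⇒≤ k′<r)))) v≡
      regions-disjoint k<k′ k′<r (inj₂ (_ , _ , _ , hangs)) (inj₁ (j , _ , j<jsk′ , v≡)) =
        hangs-off-path hangs (≤-trans (<⇒≤ j<jsk′) (joint≤L′ k′<r)) v≡
      regions-disjoint k<k′ k′<r (inj₂ (h , _ , h≤jsk , hangs)) (inj₂ (h′ , jk′<h′ , _ , hangs′))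
        with refl ← hangs-unique hangs hangs′ = <⇒≱ jk′<h′ (≤-trans h≤jsk (joint-mono-≤ k<k′ (<⇒≤ k′<r)))

      disjoint : ∀ {k k′} → k < r → k′ < r → k ≢ k′ → Disjoint ((apex k ∷ X k) ++ Y k) ((apex k′ ∷ X k′) ++ Y k′)
      disjoint {k} {k′} k<r k′<r k≢k′ (v∈ , v∈′) with <-cmp k k′
      ... | tri≈ _ k≡k′ _ = k≢k′ k≡k′
      ... | tri< k<k′ _ _ = regions-disjoint k<k′ k′<r (inRegion k<r v∈) (inRegion k′<r v∈′)
      ... | tri> _ _ k′<k = regions-disjoint k′<k k<r (inRegion k′<r v∈′) (inRegion k<r v∈)

      cycleChain : CycleChain r
      cycleChain = record
        { joint = p ∘ joint ; apex = apex ; X = X ; Y = Y ; arcX = arcX ; arcY = arcY ; unique = unique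
        ; joint∉ = joint∉ ; joint-injective = joint-injective ; disjoint = disjoint }

    long-cycle-or-cycle-chain : r * (r * r) ≤ L → LongCycle r ⊎ CycleChain r
    long-cycle-or-cycle-chain fits with block-chain r 0 fits (λ _ _ ())
    ... | inj₁ long = inj₁ long
    ... | inj₂ P    = inj₂ (FromBlocks.cycleChain P)

module DeepPath {G : Graph} {root : Vtx G} (tree : NormalSpanningTree G root) (tec : TwoEdgeConnected G)
                {K : ℕ} {w : Vtx G} (deep : K ≤ NormalSpanningTree.depth tree w) where
  open Walks G
  open NormalSpanningTree tree
  open NormalTrees tree
  open LowEdges tec
  open Ladders G using (EarSystem)

  p : ℕ → V
  p j = iterate parent w (depth w ∸ j)

  depth-p : ∀ {j} → j ≤ K → depth (p j) ≡ j
  depth-p {j} j≤K = trans (depth-iterate-∸ (depth w ∸ j) w (m∸n≤m _ j)) (m∸[m∸n]≡n (≤-trans j≤K deep))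

  p⊑w : ∀ j → p j ⊑ w
  p⊑w j = depth w ∸ j , refl

  p≢root : ∀ {j} → 1 ≤ j → j ≤ K → p j ≢ root
  p≢root 1≤j j≤K = depth-pos⇒≢root (subst (1 ≤_) (sym (depth-p j≤K)) 1≤j)

  parent-p : ∀ {j} → suc j ≤ K → parent (p (suc j)) ≡ p j
  parent-p {j} sj≤K = ⊑-unique-at-depth (⊑-trans parent⊑ (p⊑w (suc j))) (p⊑w j) (suc-injective (begin
    suc (depth (parent (p (suc j))))  ≡⟨ sym (depth-parent (p≢root (s≤s z≤n) sj≤K)) ⟩
    depth (p (suc j))                 ≡⟨ depth-p sj≤K ⟩
    suc j                             ≡⟨ cong suc (sym (depth-p (<⇒≤ sj≤K))) ⟩
    suc (depth (p j))                 ∎))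
    where open ≡-Reasoning

  parent-p-pred : ∀ {i} → 1 ≤ i → i ≤ K → parent (p i) ≡ p (pred i)
  parent-p-pred {suc i} _ i≤K = parent-p i≤K

  path-edge : ∀ {j} → j < K → Edge G (p j) (p (suc j))
  path-edge {j} j<K = subst (λ v → Edge G v (p (suc j))) (parent-p j<K) (edge-sym (edge-parent (p≢root (s≤s z≤n) j<K)))

  p-injective : ∀ {j j′} → j ≤ K → j′ ≤ K → p j ≡ p j′ → j ≡ j′
  p-injective j≤K j′≤K eq = trans (sym (depth-p j≤K)) (trans (cong depth eq) (depth-p j′≤K))

  hang : ℕ → V → ℕ
  hang zero    x = 0
  hang (suc J) x with p (suc J) ⊑? x
  ... | yes _ = suc J
  ... | no _  = hang J x

  hang-⊑ : ∀ J x → p (hang J x) ⊑ x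
  hang-⊑ zero    x = subst (_⊑ x) (sym (iterate-beyond-depth (depth w) w ≤-refl)) root⊑
  hang-⊑ (suc J) x with p (suc J) ⊑? x
  ... | yes p⊑x = p⊑x
  ... | no _    = hang-⊑ J x

  hang-≤ : ∀ J x → hang J x ≤ J
  hang-≤ zero    x = z≤n
  hang-≤ (suc J) x with p (suc J) ⊑? x
  ... | yes _ = ≤-refl
  ... | no _  = m≤n⇒m≤1+n (hang-≤ J x)

  hang-deepest : ∀ J x {j} → j ≤ J → p j ⊑ x → j ≤ hang J x
  hang-deepest zero    x z≤n _ = z≤n
  hang-deepest (suc J) x j≤sJ p⊑x with p (suc J) ⊑? x
  ... | yes _ = j≤sJ
  ... | no p⋢x with m≤n⇒m<n∨m≡n j≤sJ
  ...   | inj₁ j<sJ = hang-deepest J x (≤-pred j<sJ) p⊑x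
  ...   | inj₂ refl = ⊥-elim (p⋢x p⊑x)

  Hangs : ℕ → V → Set
  Hangs h v = h ≤ K × h < depth v × p h ⊑ v × (∀ {j} → h < j → j ≤ K → ¬ p j ⊑ v)

  hangs-off-path : ∀ {h v j} → Hangs h v → j ≤ K → v ≢ p j
  hangs-off-path (_ , h<d , _ , deepest) j≤K refl = deepest (subst (_ <_) (depth-p j≤K) h<d) j≤K ⊑-refl

  hangs-unique : ∀ {h h′ v} → Hangs h v → Hangs h′ v → h ≡ h′
  hangs-unique {h} {h′} (h≤K , _ , ph⊑ , deepest) (h′≤K , _ , ph′⊑ , deepest′) with <-cmp h h′
  ... | tri< h<h′ _ _ = ⊥-elim (deepest h<h′ h′≤K ph′⊑)
  ... | tri≈ _ h≡h′ _ = h≡h′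
  ... | tri> _ _ h′<h = ⊥-elim (deepest′ h′<h h≤K ph⊑)

  climb : V → ℕ → List V
  climb x h with depth x ≤? h
  ... | yes _ = []
  ... | no _  = x ∷ up x (depth x ∸ suc h)

  module Ear {x y : V} {h t : ℕ} (h≤K : h ≤ K) (ph⊑x : p h ⊑ x) (deepest : ∀ {j} → h < j → j ≤ K → ¬ p j ⊑ x)
             (e : Edge G x y) (y≡pt : y ≡ p t) (t<h : t < h) (not-tree-edge : h ≡ suc t → x ≡ p h → ⊥) where

    h≤depth-x : h ≤ depth x
    h≤depth-x = subst (_≤ depth x) (depth-p h≤K) (⊑⇒depth-≤ ph⊑x)

    shallow⇒x≡ph : depth x ≤ h → x ≡ p h
    shallow⇒x≡ph d≤h = sym (⊑-depth-≡⇒≡ ph⊑x (trans (depth-p h≤K) (≤-antisym h≤depth-x d≤h)))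

    pt—x : Edge G (p t) x
    pt—x = subst (λ v → Edge G v x) y≡pt (edge-sym e)

    ear-arc : Arc (p t) (p h) (climb x h)
    ear-arc with depth x ≤? h
    ... | yes d≤h = subst (λ v → Arc (p t) v []) (shallow⇒x≡ph d≤h) (pt—x ▸ stop x)
    ... | no d≰h  = pt—x ▸ subst (λ v → Arc x v (up x (depth x ∸ suc h))) reaches (up-arc x _ k<d)
      where
      h<d : h < depth x
      h<d = ≰⇒> d≰h
      k<d : suc (depth x ∸ suc h) ≤ depth x
      k<d = subst (_≤ depth x) (+-∸-assoc 1 h<d) (m∸n≤m (depth x) h)
      reaches : iterate parent x (suc (depth x ∸ suc h)) ≡ p h
      reaches = trans (cong (iterate parent x) (trans (sym (+-∸-assoc 1 h<d)) (cong (depth x ∸_) (sym (depth-p h≤K)))))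
                      (⊑-canonical ph⊑x)

    ear-unique : Unique (climb x h)
    ear-unique with depth x ≤? h
    ... | yes _ = []
    ... | no _  = up-unique x (depth x ∸ suc h) (m∸n≤m (depth x) (suc h))

    ear-hangs : ∀ {v} → v ∈ climb x h → Hangs h v
    ear-hangs {v} v∈ with depth x ≤? h
    ... | no d≰h = h≤K , h<dv , ⊑-trans ph⊑highest highest⊑v , λ h<j j≤K pj⊑v → deepest h<j j≤K (⊑-trans pj⊑v v⊑x)
      where
      h<d : h < depth x
      h<d = ≰⇒> d≰h
      k : ℕ
      k = depth x ∸ suc h
      highest : V
      highest = iterate parent x k
      v⊑x : v ⊑ x
      v⊑x = proj₁ (up-⊑ x k v∈)
      highest⊑v : highest ⊑ v
      highest⊑v = proj₂ (up-⊑ x k v∈)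
      depth-highest : depth highest ≡ suc h
      depth-highest = trans (depth-iterate-∸ k x (m∸n≤m (depth x) (suc h))) (m∸[m∸n]≡n h<d)
      h<dv : h < depth v
      h<dv = ≤-trans (≤-reflexive (sym depth-highest)) (⊑⇒depth-≤ highest⊑v)
      ph⊑highest : p h ⊑ highest
      ph⊑highest = ⊑-by-depth ph⊑x (k , refl)
        (subst (_≤ depth highest) (sym (depth-p h≤K)) (≤-trans (n≤1+n h) (≤-reflexive (sym depth-highest))))

    ear-nontrivial : 2 ≤ length (climb x h) + (h ∸ t)
    ear-nontrivial with depth x ≤? h
    ... | no _ = s≤s (≤-trans (m<n⇒0<n∸m t<h) (m≤n+m _ _))
    ... | yes d≤h with 2 ≤? h ∸ t
    ...   | yes 2≤ = 2≤
    ...   | no 2≰ = ⊥-elim (not-tree-edge (adjacent t<h (≤-pred (≰⇒> 2≰))) (shallow⇒x≡ph d≤h))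
      where
      adjacent : ∀ {a b} → b < a → a ∸ b ≤ 1 → a ≡ suc b
      adjacent {a} {b} b<a a∸b≤1 =
        trans (sym (m+[n∸m]≡n (<⇒≤ b<a))) (trans (cong (b +_) (≤-antisym a∸b≤1 (m<n⇒0<n∸m b<a))) (+-comm b 1))

  lowFrom lowTo : ℕ → V
  lowFrom i = proj₁ (lowEdge (p i))
  lowTo i   = proj₂ (lowEdge (p i))

  foot top : ℕ → ℕ
  foot i = depth (lowTo i)
  top i  = hang K (lowFrom i)

  module AtPath {i} (1≤i : 1 ≤ i) (i≤K : i ≤ K) where

    low : LowEdge (p i) (lowFrom i) (lowTo i)
    low = lowEdge-spec (p≢root 1≤i i≤K)

    pi⊑x : p i ⊑ lowFrom i
    pi⊑x = proj₁ low

    parent-pi : parent (p i) ≡ p (pred i)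
    parent-pi = parent-p-pred 1≤i i≤K

    y⊑parent : lowTo i ⊑ parent (p i)
    y⊑parent = proj₁ (proj₂ (proj₂ low))

    foot<i : foot i < i
    foot<i = ≤-<-trans (⊑⇒depth-≤ y⊑parent)
                       (≤-<-trans (≤-reflexive (trans (cong depth parent-pi) (depth-p (≤-trans pred[n]≤n i≤K)))) (pred< 1≤i))
      where
      pred< : ∀ {n} → 1 ≤ n → pred n < n
      pred< {suc n} _ = ≤-refl

    y≡p-foot : lowTo i ≡ p (foot i)
    y≡p-foot = ⊑-unique-at-depth (⊑-trans y⊑parent (⊑-trans parent⊑ (p⊑w i))) (p⊑w (foot i))
                                 (sym (depth-p (≤-trans (<⇒≤ foot<i) i≤K)))

    i≤top : i ≤ top i
    i≤top = hang-deepest K (lowFrom i) i≤K pi⊑x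

    top≤K : top i ≤ K
    top≤K = hang-≤ K (lowFrom i)

    not-tree-edge : top i ≡ suc (foot i) → lowFrom i ≡ p (top i) → ⊥
    not-tree-edge top≡ x≡ =
      proj₂ (proj₂ (proj₂ low)) (trans x≡ (cong p top≡i) , trans y≡p-foot (trans (cong p foot≡) (sym parent-pi)))
      where
      top≡i : top i ≡ i
      top≡i = ≤-antisym (subst (_≤ i) (sym top≡) foot<i) i≤top
      foot≡ : foot i ≡ pred i
      foot≡ = cong pred (trans (sym top≡) top≡i)

    open Ear top≤K (hang-⊑ K (lowFrom i)) (λ top<j j≤K pj⊑x → <⇒≱ top<j (hang-deepest K (lowFrom i) j≤K pj⊑x))
             (proj₁ (proj₂ low)) y≡p-foot (<-≤-trans foot<i i≤top) not-tree-edge public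

  earSystem : EarSystem K
  earSystem = record
    { p = p ; path-edge = path-edge ; p-injective = p-injective
    ; Hangs = Hangs ; hangs-off-path = hangs-off-path ; hangs-unique = hangs-unique
    ; foot = foot ; top = top ; ear = λ i → climb (lowFrom i) (top i)
    ; ear-arc = AtPath.ear-arc ; ear-unique = AtPath.ear-unique ; ear-hangs = λ 1≤i i≤K → AtPath.ear-hangs 1≤i i≤K
    ; ear-nontrivial = AtPath.ear-nontrivial ; foot< = AtPath.foot<i ; ≤top = AtPath.i≤top ; top≤ = AtPath.top≤K }

module _ {r : ℕ} {G : Graph} where
  open Flowers G using (Flower; hasFlower; TriFlower-topMinor)
  open K2rSubdivisions G using (SubdividedK2r; hasK2rSubdivision; K2-topMinor)
  open LongCycles G using (LongCycle; hasLongCycle; CycleGraph-topMinor)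
  open CycleChains G using (CycleChain; hasCycleChain; TriChain-topMinor)

  flower-or-K2r⇒parts : Flower r ⊎ SubdividedK2r r → PartA r G × PartB r G
  flower-or-K2r⇒parts (inj₁ F) = inj₁ (hasFlower F) , inj₁ (TriFlower-topMinor F)
  flower-or-K2r⇒parts (inj₂ K) = inj₂ (inj₂ (inj₂ (hasK2rSubdivision K))) , inj₂ (inj₂ (inj₂ (K2-topMinor K)))

  longCycle-or-chain⇒parts : 3 ≤ r → LongCycle r ⊎ CycleChain r → PartA r G × PartB r G
  longCycle-or-chain⇒parts 3≤r (inj₁ C) = inj₂ (inj₁ (hasLongCycle C)) , inj₂ (inj₁ (CycleGraph-topMinor C 3≤r))
  longCycle-or-chain⇒parts _   (inj₂ C) = inj₂ (inj₂ (inj₁ (hasCycleChain C))) , inj₂ (inj₂ (inj₁ (TriChain-topMinor C)))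

tree⇒parts : ∀ {r G root} → 3 ≤ r → TwoEdgeConnected G → NormalSpanningTree G root →
             suc (powerSum (r * (r * (r * r))) (r * (r * r))) ≤ order G → PartA r G × PartB r G
tree⇒parts {r} {G} 3≤r tec tree large with NormalTrees.deep-or-bushy tree (r * (r * r)) (r * (r * (r * r))) large
... | inj₁ (w , deep) = longCycle-or-chain⇒parts 3≤r
  (Ladders.Ladder.long-cycle-or-cycle-chain G (DeepPath.earSystem tree tec deep) (≤-trans (s≤s z≤n) 3≤r) ≤-refl)
... | inj₂ (shallow , u , bushy) = flower-or-K2r⇒parts
  (ManyChildren.flower-or-K2r tree tec (≤-trans (s≤s z≤n) 3≤r) shallow bushy)

theorem4p1 : (r : ℕ) → 3 ≤ r →
    Σ ℕ λ f → (G : Graph) → TwoEdgeConnected G → f ≤ order G →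
      PartA r G × PartB r G
theorem4p1 r 3≤r = suc (powerSum (r * (r * (r * r))) (r * (r * r))) , λ G tec large →
  tree⇒parts 3≤r tec (normalSpanningTree (fromℕ< (≤-trans (s≤s z≤n) (proj₁ tec))) (proj₁ (proj₂ tec))) large
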